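{- Let $\mathcal D$ be a 3-periodic dissection of the convex $(n+2)$-gon. Then $\mathcal D$ can be transformed into a maximally open 3-periodic dissection by a finite sequence of 3-periodic opening surgeries (each applied to the dissection produced by the preceding ones).
   Context: Fix $n\ge1$ and a convex $(n+2)$-gon with vertices labelled $0,1,\dots,n+1$ in counterclockwise cyclic order; its edges are the segments $(i,i+1)$, $i\in\mathbb Z/(n+2)$, and its base edge is $(n+1,0)$. A dissection is a set of pairwise non-crossing diagonals (chords), partitioning the polygon into sub-polygons (cells); the sides of a cell are the edges and chords bounding it. The quiddity of a dissection is $(a_0,\dots,a_{n+1})$ with $a_i$ the number of cells having vertex $i$. A dissection is 3-periodic if every cell has a number of vertices divisible by 3. The base cell is the cell containing the base edge. For a cell with vertices $0\le v_0<v_1<\dots<v_{r+1}\le n+1$, its sides are $(v_s,v_{s+1})$ for $0\le s\le r+1$, where $v_{r+2}:=v_0$; its base side is $(v_{r+1},v_0)$ (the base edge for the base cell; for any other cell, the unique chord side separating it from the base cell). The parent of a non-base cell is the other cell containing its base side; the level of a cell is its number of iterated parents (ancestors). $\mathbb Z_3$-index (for 3-periodic dissections): defined recursively on level; the base edge has index $0$, and if the base side of a cell with vertices $v_0<\dots<v_{r+1}$ has index $c$ then its side $(v_s,v_{s+1})$ has index $c+s+1 \bmod 3$, $0\le s\le r$ (each chord is a non-base side of exactly one cell and gets its index from it). Two sides $(v_s,v_{s+1}),(v_{s'},v_{s'+1})$, $0\le s<s'\le r+1$, of such a cell are distant if $s'\ge s+3$ and $s\ge s'+3-(r+2)$. If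 two distant sides are both chords, surgery on them removes these two chords and adds the chords $(v_{s+1},v_{s'})$ and $(v_{s'+1},v_s)$. A 3-periodic surgery is a surgery on two distant chord sides of a cell having the same $\mathbb Z_3$-index; it is opening if one of the two sides is the base side of that cell. A cell is maximally open if it admits no 3-periodic opening surgery; a 3-periodic dissection is maximally open if all its cells are. -}

module Defs where

open import Data.Nat using (ℕ; zero; suc; _+_; _∸_; _≤_; _<_; _%_; _⊓_; _⊔_)
open import Data.Bool using (if_then_else_)
open import Data.Product using (_×_; _,_; ∃; Σ)
open import Data.Sum using (_⊎_)
open import Data.List using (List; []; _∷_; length)
open import Data.List.Membership.Propositional using (_∈_)
open import Relation.Binary.PropositionalEquality using (_≡_; _≢_)
open import Relation.Nullary using (¬_)

-- Vertices of the convex (n+2)-gon are the naturals 0 .. n+1.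
-- A chord (diagonal) is stored as an ordered pair (i , j) with i < j.
Pt : Set
Pt = ℕ × ℕ

IsChord : ℕ → Pt → Set
IsChord n (i , j) = (i + 2 ≤ j) × (j ≤ suc n) × ¬ ((i ≡ 0) × (j ≡ suc n))

IsEdge : ℕ → Pt → Set
IsEdge n (i , j) = (j ≡ suc i) ⊎ ((i ≡ 0) × (j ≡ suc n))

Cross : Pt → Pt → Set
Cross (a , b) (c , d) = (a < c) × (c < b) × (b < d)

record Dissection (n : ℕ) (D : List Pt) : Set where
  field
    chords      : ∀ p → p ∈ D → IsChord n p
    nonCrossing : ∀ p q → p ∈ D → q ∈ D → ¬ Cross p q

IsSide : ℕ → List Pt → Pt → Set
IsSide n D p = IsEdge n p ⊎ p ∈ D

-- s-th entry of a list (0 if out of range; only used in range)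
_!_ : List ℕ → ℕ → ℕ
[] ! _ = 0
(x ∷ xs) ! zero = x
(x ∷ xs) ! suc s = xs ! s

-- For a cell with vertex list vs = v_0 < v_1 < ... < v_{r+1}  (k = r+2
-- vertices), side s (0 ≤ s ≤ r+1) is (v_s , v_{s+1}) with v_{r+2} := v_0,
-- stored with smaller endpoint first.  Side r+1 = (v_0 , v_{r+1}) is the
-- base side.
side : List ℕ → ℕ → Pt
side vs s = if suc s Data.Nat.<ᵇ length vs then (vs ! s , vs ! suc s) else (vs ! 0 , vs ! s)

baseSide : List ℕ → Pt
baseSide vs = (vs ! 0 , vs ! (length vs ∸ 1))

-- vs is (the increasing vertex list of) a cell of the dissection D:
-- a sub-polygon with at least 3 vertices all of whose sides are edges or
-- chords of D and which contains no chord of D in its interior (i.e. no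
-- chord of D joins two non-consecutive vertices of vs).
record Cell (n : ℕ) (D : List Pt) (vs : List ℕ) : Set where
  field
    atLeast3   : 3 ≤ length vs
    inRange    : ∀ s → s < length vs → vs ! s ≤ suc n
    increasing : ∀ s → suc s < length vs → vs ! s < vs ! suc s
    sides      : ∀ s → s < length vs → IsSide n D (side vs s)
    empty      : ∀ s t → s < t → t < length vs → ¬ (t ≡ suc s)
                   → ¬ ((s ≡ 0) × (suc t ≡ length vs))
                   → ¬ ((vs ! s , vs ! t) ∈ D)

ThreePeriodic : ℕ → List Pt → Set
ThreePeriodic n D = ∀ vs → Cell n D vs → length vs % 3 ≡ 0

data Index (n : ℕ) (D : List Pt) : Pt → ℕ → Set where
  base : Index n D (0 , suc n) 0
  step : ∀ {vs c s} → Cell n D vs → Index n D (baseSide vs) c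
       → suc s < length vs
       → Index n D (side vs s) ((c + s + 1) % 3)

Distant : ℕ → ℕ → ℕ → Set
Distant k s s' = (s + 3 ≤ s') × (s' + 3 ≤ s + k)

chordOf : ℕ → ℕ → Pt
chordOf a b = (a ⊓ b , a ⊔ b)

vtx : List ℕ → ℕ → ℕ
vtx vs t = if t Data.Nat.<ᵇ length vs then vs ! t else vs ! 0

record OpeningSurgery (n : ℕ) (D : List Pt) (vs : List ℕ) (s s' : ℕ) : Set where
  field
    cell     : Cell n D vs
    isBase   : suc s' ≡ length vs
    lt       : s < s'
    distant  : Distant (length vs) s s'
    chord₁   : side vs s ∈ D
    chord₂   : side vs s' ∈ D
    sameIdx  : ∃ λ c → Index n D (side vs s) c × Index n D (side vs s') c

newChord₁ newChord₂ : List ℕ → ℕ → ℕ → Pt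
newChord₁ vs s s' = chordOf (vtx vs (suc s)) (vtx vs s')
newChord₂ vs s s' = chordOf (vtx vs (suc s')) (vtx vs s)

SurgeryResult : List Pt → List ℕ → ℕ → ℕ → List Pt → Set
SurgeryResult D vs s s' D' =
  ∀ p → (p ∈ D' → Rhs p) × (Rhs p → p ∈ D')
  where
  Rhs : Pt → Set
  Rhs p = ((p ∈ D) × (p ≢ side vs s) × (p ≢ side vs s'))
          ⊎ (p ≡ newChord₁ vs s s') ⊎ (p ≡ newChord₂ vs s s')

OpeningStep : ℕ → List Pt → List Pt → Set
OpeningStep n D D' =
  Dissection n D × ThreePeriodic n D × Dissection n D' ×
  Σ (List ℕ) λ vs → Σ ℕ λ s → Σ ℕ λ s' →
    OpeningSurgery n D vs s s' × SurgeryResult D vs s s' D'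

MaximallyOpen : ℕ → List Pt → Set
MaximallyOpen n D = ∀ vs s s' → ¬ OpeningSurgery n D vs s s'

-- A cell is determined by its base side q = (a , b): its vertices are the x with a ≤ x ≤ b that
-- no chord nested in q hides, i.e. no such chord (c , d) ≠ q has c < x < d (cellOf).  Since the
-- index of side s of a cell is (c + s + 1) mod 3 when its base side has index c, an opening
-- surgery exists in a cell V exactly when the base side of V is a chord and some chord side s
-- with 2 ≤ s and s + 4 ≤ |V| has 3 ∣ s + 1.  It replaces the chords (v₀ , v_last) and
-- (v_s , v_{s+1}) by (v₀ , v_s) and (v_{s+1} , v_last).  The new cells are v₀ … v_s,
-- v_{s+1} … v_last and the union of the parent of V with the cell beyond (v_s , v_{s+1}); every
-- other cell is unchanged, so 3-periodicity is preserved.  The total span Σ (b − a) of the chords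
-- strictly decreases, so performing surgeries while one exists ends in a maximally open
-- dissection.

module Submission where

open import Defs
open import Data.Bool using (T; false; true)
open import Data.Empty using (⊥; ⊥-elim)
open import Data.List using (List; []; _∷_; drop; filter; length; map; take; upTo)
open import Data.List.Membership.Propositional using (_∈_; _∉_; find; lose)
open import Data.List.Membership.Propositional.Properties using (∈-filter⁺; ∈-filter⁻; ∈-upTo⁺)
open import Data.List.Properties using (filter-≐; length-drop; length-take)
open import Data.List.Relation.Binary.Subset.Propositional using (_⊆_)
open import Data.List.Relation.Unary.AllPairs using (AllPairs; []; _∷_)
open import Data.List.Relation.Unary.Any using (any?; here; there)
open import Data.Nat using (_%_; _*_; _+_; _/_; _<?_; _<_; _<ᵇ_; _∸_; _≟_; _≤?_; _≤_; suc; s≤s; zero; z≤n; ℕ)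
open import Data.Nat.DivMod using ([m+kn]%n≡m%n; m%n<n; m<n⇒m%n≡m; m≡m%n+[m/n]*n)
open import Data.Nat.Divisibility using (_∣?_; _∣_; divides; m%n≡0⇒n∣m; n∣m⇒m%n≡0; ∣m+n∣m⇒∣n; ∣m∣n⇒∣m+n)
open import Data.Nat.ListAction using (sum)
open import Data.Nat.Properties
open import Data.Product using (_,_; _×_; proj₁; proj₂; ∃)
open import Data.Product.Properties using (≡-dec)
open import Data.Sum using ([_,_]′; _⊎_; inj₁; inj₂)
open import Data.Unit using (tt)
open import Function using (id)
open import Level using (0ℓ)
open import Relation.Binary.Construct.Closure.ReflexiveTransitive using (Star; _◅_; ε)
open import Relation.Binary.Definitions using (tri<; tri>; tri≈)
open import Relation.Binary.PropositionalEquality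
open import Relation.Nullary using (Dec; no; yes; ¬?; ¬_)
open import Relation.Nullary.Decidable using (_×-dec_; map′)
open import Relation.Unary using (Decidable; Pred)
open import Relation.Unary.Properties using (_∪?_)
import Data.List.Relation.Unary.AllPairs.Properties as AllPairs
open import Data.List.Relation.Unary.All as All using (All; []; _∷_)

private
  variable
    x : ℕ
    xs ys : List ℕ

-- Increasing lists, indexed with _!_

_∈!_ : ℕ → List ℕ → Set
x ∈! xs = ∃ λ t → t < length xs × xs ! t ≡ x

∈⇒∈! : x ∈ xs → x ∈! xs
∈⇒∈! (here refl) = 0 , s≤s z≤n , refl
∈⇒∈! (there p) with t , t< , eq ← ∈⇒∈! p = suc t , s≤s t< , eq

∈!⇒∈ : x ∈! xs → x ∈ xs
∈!⇒∈ {xs = _ ∷ _} (zero , _ , refl) = here refl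
∈!⇒∈ {xs = _ ∷ _} (suc t , s≤s t< , eq) = there (∈!⇒∈ (t , t< , eq))

!-∈ : ∀ {t} → t < length xs → xs ! t ∈ xs
!-∈ t< = ∈!⇒∈ (_ , t< , refl)

record Increasing (vs : List ℕ) : Set where
  constructor mkIncreasing
  field consecutive-< : ∀ s → suc s < length vs → vs ! s < vs ! suc s
open Increasing public

increasing-tail : Increasing (x ∷ xs) → Increasing xs
increasing-tail inc = mkIncreasing λ s s+1< → consecutive-< inc (suc s) (s≤s s+1<)

increasing-head : Increasing (x ∷ xs) → All (x <_) xs
increasing-head {xs = []} inc = []
increasing-head {xs = y ∷ ys} inc =
  x<y ∷ All.map (<-trans x<y) (increasing-head (increasing-tail inc))
  where x<y = consecutive-< inc 0 (s≤s (s≤s z≤n))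

Increasing⇒AllPairs : Increasing xs → AllPairs _<_ xs
Increasing⇒AllPairs {[]} inc = []
Increasing⇒AllPairs {_ ∷ _} inc = increasing-head inc ∷ Increasing⇒AllPairs (increasing-tail inc)

AllPairs⇒Increasing : AllPairs _<_ xs → Increasing xs
AllPairs⇒Increasing sorted = mkIncreasing (consecutive sorted)
  where
  consecutive : AllPairs _<_ xs → ∀ s → suc s < length xs → xs ! s < xs ! suc s
  consecutive ((x<y ∷ _) ∷ _) zero _ = x<y
  consecutive (_ ∷ sorted) (suc s) (s≤s s+1<) = consecutive sorted s s+1<

all-! : ∀ {P : Pred ℕ 0ℓ} {t} → All P xs → t < length xs → P (xs ! t)
all-! {t = zero} (px ∷ _) _ = px
all-! {t = suc t} (_ ∷ pxs) (s≤s t<) = all-! pxs t<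

increasing-< : Increasing xs → ∀ i j → i < j → j < length xs → xs ! i < xs ! j
increasing-< {_ ∷ _} inc zero (suc j) _ (s≤s j<) = all-! (increasing-head inc) j<
increasing-< {_ ∷ _} inc (suc i) (suc j) (s≤s i<j) (s≤s j<) = increasing-< (increasing-tail inc) i j i<j j<

increasing-≤ : Increasing xs → ∀ i j → i ≤ j → j < length xs → xs ! i ≤ xs ! j
increasing-≤ inc i j i≤j j< with m≤n⇒m<n∨m≡n i≤j
... | inj₁ i<j = <⇒≤ (increasing-< inc i j i<j j<)
... | inj₂ refl = ≤-refl

increasing-cancel-< : Increasing xs → ∀ i j → i < length xs → xs ! i < xs ! j → i < j
increasing-cancel-< inc i j i< lt = ≰⇒> (λ j≤i → <⇒≱ lt (increasing-≤ inc j i j≤i i<))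

increasing-injective : Increasing xs → ∀ i j → i < length xs → j < length xs → xs ! i ≡ xs ! j → i ≡ j
increasing-injective inc i j i< j< eq with <-cmp i j
... | tri< i<j _ _ = ⊥-elim (<-irrefl eq (increasing-< inc i j i<j j<))
... | tri≈ _ i≡j _ = i≡j
... | tri> _ _ j<i = ⊥-elim (<-irrefl (sym eq) (increasing-< inc j i j<i i<))

sorted-≡ : AllPairs _<_ xs → AllPairs _<_ ys → xs ⊆ ys → ys ⊆ xs → xs ≡ ys
sorted-≡ {[]} {[]} _ _ _ _ = refl
sorted-≡ {[]} {_ ∷ _} _ _ _ ys⊆xs with () ← ys⊆xs (here refl)
sorted-≡ {_ ∷ _} {[]} _ _ xs⊆ys _ with () ← xs⊆ys (here refl)
sorted-≡ {x ∷ xs} {y ∷ ys} (x< ∷ sx) (y< ∷ sy) xs⊆ys ys⊆xs = cong₂ _∷_ x≡y tails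
  where
  x≡y : x ≡ y
  x≡y with xs⊆ys (here refl) | ys⊆xs (here refl)
  ... | here e | _ = e
  ... | there _ | here e = sym e
  ... | there x∈ys | there y∈xs = ⊥-elim (<-asym (All.lookup x< y∈xs) (All.lookup y< x∈ys))
  tail⊆ : ∀ {u us v vs} → u ≡ v → All (u <_) us → u ∷ us ⊆ v ∷ vs → us ⊆ vs
  tail⊆ refl u< ⊆ z∈ with ⊆ (there z∈)
  ... | here refl = ⊥-elim (<-irrefl refl (All.lookup u< z∈))
  ... | there z∈′ = z∈′
  tails : xs ≡ ys
  tails = sorted-≡ sx sy (tail⊆ x≡y x< xs⊆ys) (tail⊆ (sym x≡y) y< ys⊆xs)

∈-take⁻ : ∀ m → x ∈ take m xs → ∃ λ t → t < m × t < length xs × xs ! t ≡ x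
∈-take⁻ {xs = _ ∷ _} (suc m) (here refl) = 0 , s≤s z≤n , s≤s z≤n , refl
∈-take⁻ {xs = _ ∷ _} (suc m) (there x∈) with t , t<m , t< , eq ← ∈-take⁻ m x∈ =
  suc t , s≤s t<m , s≤s t< , eq

∈-take⁺ : ∀ m t → t < m → t < length xs → xs ! t ∈ take m xs
∈-take⁺ {_ ∷ _} (suc m) zero _ _ = here refl
∈-take⁺ {_ ∷ _} (suc m) (suc t) (s≤s t<m) (s≤s t<) = there (∈-take⁺ m t t<m t<)

∈-drop⁻ : ∀ m → x ∈ drop m xs → ∃ λ t → m ≤ t × t < length xs × xs ! t ≡ x
∈-drop⁻ zero x∈ with t , t< , eq ← ∈⇒∈! x∈ = t , z≤n , t< , eq
∈-drop⁻ {xs = _ ∷ _} (suc m) x∈ with t , m≤t , t< , eq ← ∈-drop⁻ m x∈ =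
  suc t , s≤s m≤t , s≤s t< , eq

∈-drop⁺ : ∀ m t → m ≤ t → t < length xs → xs ! t ∈ drop m xs
∈-drop⁺ zero t _ t< = !-∈ t<
∈-drop⁺ {_ ∷ _} (suc m) (suc t) (s≤s m≤t) (s≤s t<) = ∈-drop⁺ m t m≤t t<

length-filter-∪ : ∀ {A : Set} {P Q : Pred A 0ℓ} (P? : Decidable P) (Q? : Decidable Q) →
                  (∀ {x} → P x → ¬ Q x) → ∀ xs →
                  length (filter (P? ∪? Q?) xs) ≡ length (filter P? xs) + length (filter Q? xs)
length-filter-∪ P? Q? disjoint [] = refl
length-filter-∪ P? Q? disjoint (x ∷ xs) with P? x | Q? x
... | yes p | yes q = ⊥-elim (disjoint p q)
... | yes _ | no _ = cong suc (length-filter-∪ P? Q? disjoint xs)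
... | no _ | yes _ = trans (cong suc (length-filter-∪ P? Q? disjoint xs)) (sym (+-suc _ _))
... | no _ | no _ = length-filter-∪ P? Q? disjoint xs

_≟ᴾ_ : (p q : Pt) → Dec (p ≡ q)
_≟ᴾ_ = ≡-dec _≟_ _≟_

∃∈? : {A : Set} {P : Pred A 0ℓ} → Decidable P → (xs : List A) → Dec (∃ λ x → x ∈ xs × P x)
∃∈? P? xs = map′ find (λ (_ , x∈ , Px) → lose x∈ Px) (any? P? xs)

<ᵇ-true : ∀ {m n} → m < n → (m <ᵇ n) ≡ true
<ᵇ-true {m} {n} m<n with m <ᵇ n | <⇒<ᵇ m<n
... | true | _ = refl

<ᵇ-false : ∀ {m n} → ¬ m < n → (m <ᵇ n) ≡ false
<ᵇ-false {m} {n} m≮n with m <ᵇ n in eq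
... | false = refl
... | true = ⊥-elim (m≮n (<ᵇ⇒< m n (subst T (sym eq) tt)))

side-inner : ∀ vs s → suc s < length vs → side vs s ≡ (vs ! s , vs ! suc s)
side-inner vs s s+1< rewrite <ᵇ-true s+1< = refl

side-last : ∀ vs s → suc s ≡ length vs → side vs s ≡ (vs ! 0 , vs ! s)
side-last vs s eq rewrite <ᵇ-false {suc s} {length vs} (<-irrefl eq) = refl

-- The cell with a given base side

baseEdge : ℕ → Pt
baseEdge n = (0 , suc n)

CellBase : ℕ → List Pt → Pt → Set
CellBase n D q = q ∈ D ⊎ q ≡ baseEdge n

Hides : Pt → ℕ → Pt → Set
Hides (a , b) x (c , d) = (c , d) ≢ (a , b) × a ≤ c × d ≤ b × c < x × x < d

Hides? : ∀ q x → Decidable (Hides q x)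
Hides? (a , b) x (c , d) =
  ¬? ((c , d) ≟ᴾ (a , b)) ×-dec (a ≤? c) ×-dec (d ≤? b) ×-dec (c <? x) ×-dec (x <? d)

Hidden : List Pt → Pt → ℕ → Set
Hidden D q x = ∃ λ p → p ∈ D × Hides q x p

OnCell : List Pt → Pt → ℕ → Set
OnCell D (a , b) x = a ≤ x × x ≤ b × ¬ Hidden D (a , b) x

OnCell? : ∀ D q → Decidable (OnCell D q)
OnCell? D (a , b) x = (a ≤? x) ×-dec (x ≤? b) ×-dec ¬? (∃∈? (Hides? (a , b) x) D)

off⇒hidden : ∀ {D a b x} → a ≤ x → x ≤ b → ¬ OnCell D (a , b) x → Hidden D (a , b) x
off⇒hidden {D} {a} {b} {x} a≤x x≤b off with ∃∈? (Hides? (a , b) x) D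
... | yes hidden = hidden
... | no not-hidden = ⊥-elim (off (a≤x , x≤b , not-hidden))

cellOf : List Pt → Pt → List ℕ
cellOf D q = filter (OnCell? D q) (upTo (suc (proj₂ q)))

cellOf-sorted : ∀ D q → AllPairs _<_ (cellOf D q)
cellOf-sorted D q = AllPairs.filter⁺ (OnCell? D q) (AllPairs.applyUpTo⁺₁ id _ (λ i<j _ → i<j))

cellOf-increasing : ∀ D q → Increasing (cellOf D q)
cellOf-increasing D q = AllPairs⇒Increasing (cellOf-sorted D q)

∈-cellOf⁻ : ∀ {D q x} → x ∈ cellOf D q → OnCell D q x
∈-cellOf⁻ {D} {q} x∈ = proj₂ (∈-filter⁻ (OnCell? D q) x∈)

∈-cellOf⁺ : ∀ {D q x} → OnCell D q x → x ∈ cellOf D q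
∈-cellOf⁺ {D} {q} on@(_ , x≤b , _) = ∈-filter⁺ (OnCell? D q) (∈-upTo⁺ (s≤s x≤b)) on

gap : ∀ {vs} → Increasing vs → ∀ {x} l → suc l ≡ length vs → vs ! 0 ≤ x → x < vs ! l →
      ∃ λ u → suc u < length vs × vs ! u ≤ x × x < vs ! suc u
gap {_ ∷ []} inc zero refl v≤x x<v = ⊥-elim (<⇒≱ x<v v≤x)
gap {_ ∷ _ ∷ _} inc zero ()
gap {_ ∷ []} inc (suc l) ()
gap {v ∷ w ∷ vs} inc {x} (suc l) eq v≤x x<vl with w ≤? x
... | no w≰x = 0 , s≤s (s≤s z≤n) , v≤x , ≰⇒> w≰x
... | yes w≤x with u , u+1< , lo , hi ← gap (increasing-tail inc) l (suc-injective eq) w≤x x<vl =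
  suc u , s≤s u+1< , lo , hi

-- Every cell is the cell of its base side

module CellFacts {n : ℕ} {D : List Pt} {vs : List ℕ} (dis : Dissection n D) (C : Cell n D vs) where
  open Cell C
  open Dissection dis

  k : ℕ
  k = length vs

  inc : Increasing vs
  inc = mkIncreasing increasing

  v : ℕ → ℕ
  v t = vs ! t

  0<k : 0 < k
  0<k = ≤-trans (s≤s z≤n) atLeast3

  1<k : 1 < k
  1<k = ≤-trans (s≤s (s≤s z≤n)) atLeast3

  last : ℕ
  last = k ∸ 1

  suc-last : suc last ≡ k
  suc-last = m+[n∸m]≡n 0<k

  last<k : last < k
  last<k = subst (last <_) suc-last ≤-refl

  last-unique : ∀ j → suc j ≡ k → j ≡ last
  last-unique j eq = suc-injective (trans eq (sym suc-last))

  ≤last : ∀ t → t < k → t ≤ last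
  ≤last t t<k = ≤-pred (subst (t <_) (sym suc-last) t<k)

  2≤last : 2 ≤ last
  2≤last = ≤-pred (subst (3 ≤_) (sym suc-last) atLeast3)

  a b : ℕ
  a = v 0
  b = v last

  a≤v : ∀ t → t < k → a ≤ v t
  a≤v t t<k = increasing-≤ inc 0 t z≤n t<k

  v≤b : ∀ t → t < k → v t ≤ b
  v≤b t t<k = increasing-≤ inc t last (≤last t t<k) last<k

  b≤n+1 : b ≤ suc n
  b≤n+1 = inRange last last<k

  a+2≤b : a + 2 ≤ b
  a+2≤b = subst (_≤ b) (+-comm 2 a)
            (≤-trans (s≤s (increasing-< inc 0 1 (s≤s z≤n) 1<k)) (increasing-< inc 1 last 2≤last last<k))

  gap< : ∀ x → a ≤ x → x < b → ∃ λ u → suc u < k × v u ≤ x × x < v (suc u)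
  gap< x a≤x x<b = gap inc last suc-last a≤x x<b

  gap≤ : ∀ y → a < y → y ≤ b → ∃ λ u → suc u < k × v u < y × y ≤ v (suc u)
  gap≤ (suc y) a<y y≤b with u , u+1< , lo , hi ← gap< y (≤-pred a<y) y≤b = u , u+1< , s≤s lo , hi

  inner-side≢baseEdge : ∀ u → suc u < k → (v u , v (suc u)) ≢ baseEdge n
  inner-side≢baseEdge zero _ eq =
    <⇒≱ (subst (_< v 2) (cong proj₂ eq) (increasing-< inc 1 2 ≤-refl atLeast3)) (inRange 2 atLeast3)
  inner-side≢baseEdge (suc u) u+2< eq =
    n≮0 (subst (v u <_) (cong proj₁ eq) (increasing-< inc u (suc u) ≤-refl (<-trans (n<1+n (suc u)) u+2<)))

  inner-side-class : ∀ u → suc u < k → (v u , v (suc u)) ∈ D ⊎ v (suc u) ≡ suc (v u)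
  inner-side-class u u+1< with subst (IsSide n D) (side-inner vs u u+1<) (sides u (<-trans (n<1+n u) u+1<))
  ... | inj₂ side∈D = inj₁ side∈D
  ... | inj₁ (inj₁ edge) = inj₂ edge
  ... | inj₁ (inj₂ (vu≡0 , vu+1≡n+1)) = ⊥-elim (inner-side≢baseEdge u u+1< (cong₂ _,_ vu≡0 vu+1≡n+1))

  inner-side-uncrossed : ∀ u → suc u < k → ∀ c d → (c , d) ∈ D →
                         ¬ Cross (v u , v (suc u)) (c , d) × ¬ Cross (c , d) (v u , v (suc u))
  inner-side-uncrossed u u+1< c d cd∈D with inner-side-class u u+1<
  ... | inj₁ side∈D = nonCrossing _ _ side∈D cd∈D , nonCrossing _ _ cd∈D side∈D
  ... | inj₂ edge = (λ (lo , hi , _) → nothing-between lo hi) , (λ (_ , lo , hi) → nothing-between lo hi)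
    where
    nothing-between : ∀ {x} → v u < x → x < v (suc u) → ⊥
    nothing-between lo hi = <⇒≱ (subst (_ <_) edge hi) lo

  inner-side≢ : ∀ u → suc u < k → (v u , v (suc u)) ≢ (a , b)
  inner-side≢ u u+1< eq with subst (2 ≤_) (trans (sym u+1≡last) (cong suc u≡0)) 2≤last
    where
    u≡0 : u ≡ 0
    u≡0 = increasing-injective inc u 0 (<-trans (n<1+n u) u+1<) 0<k (cong proj₁ eq)
    u+1≡last : suc u ≡ last
    u+1≡last = increasing-injective inc (suc u) last u+1< last<k (cong proj₂ eq)
  ... | s≤s ()

  vertex-not-hidden : ∀ t → t < k → ¬ Hidden D (a , b) (v t)
  vertex-not-hidden t t<k ((c , d) , cd∈D , cd≢ab , a≤c , d≤b , c<vt , vt<d)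
    with gap< c a≤c (<-≤-trans c<vt (v≤b t t<k)) | gap≤ d (≤-<-trans (a≤v t t<k) vt<d) d≤b
  ... | u , u+1< , vu≤c , c<vu+1 | w , w+1< , vw<d , d≤vw+1 =
    empty u (suc w) (<-trans u<w (n<1+n w)) w+1< (λ e → <-irrefl (sym (suc-injective e)) u<w) not-base
          (subst₂ (λ c′ d′ → (c′ , d′) ∈ D) (sym vu≡c) d≡vw+1 cd∈D)
    where
    u<k = <-trans (n<1+n u) u+1<
    u<t : u < t
    u<t = increasing-cancel-< inc u t u<k (≤-<-trans vu≤c c<vt)
    t≤w : t ≤ w
    t≤w = ≤-pred (increasing-cancel-< inc t (suc w) t<k (<-≤-trans vt<d d≤vw+1))
    u<w : u < w
    u<w = <-≤-trans u<t t≤w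
    vu≡c : v u ≡ c
    vu≡c with m≤n⇒m<n∨m≡n vu≤c
    ... | inj₂ vu≡c = vu≡c
    ... | inj₁ vu<c = ⊥-elim (proj₁ (inner-side-uncrossed u u+1< c d cd∈D)
                          (vu<c , c<vu+1 , ≤-<-trans (increasing-≤ inc (suc u) t u<t t<k) vt<d))
    d≡vw+1 : d ≡ v (suc w)
    d≡vw+1 with m≤n⇒m<n∨m≡n d≤vw+1
    ... | inj₂ d≡vw+1 = d≡vw+1
    ... | inj₁ d<vw+1 = ⊥-elim (proj₂ (inner-side-uncrossed w w+1< c d cd∈D)
                          (<-≤-trans c<vt (increasing-≤ inc t w t≤w (<-trans (n<1+n w) w+1<)) , vw<d , d<vw+1))
    not-base : ¬ ((u ≡ 0) × (suc (suc w) ≡ k))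
    not-base (u≡0 , w+2≡k) = cd≢ab (cong₂ _,_ (trans (sym vu≡c) (cong v u≡0))
                                              (trans d≡vw+1 (cong v (last-unique (suc w) w+2≡k))))

  onCell⇒∈ : ∀ {x} → OnCell D (a , b) x → x ∈ vs
  onCell⇒∈ {x} (a≤x , x≤b , not-hidden) with m≤n⇒m<n∨m≡n x≤b
  ... | inj₂ refl = !-∈ last<k
  ... | inj₁ x<b with gap< x a≤x x<b
  ... | u , u+1< , vu≤x , x<vu+1 with m≤n⇒m<n∨m≡n vu≤x
  ...   | inj₂ refl = !-∈ (<-trans (n<1+n u) u+1<)
  ...   | inj₁ vu<x with inner-side-class u u+1<
  ...     | inj₂ edge = ⊥-elim (<⇒≱ (subst (x <_) edge x<vu+1) vu<x)
  ...     | inj₁ side∈D = ⊥-elim (not-hidden (_ , side∈D , inner-side≢ u u+1< ,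
                                   a≤v u (<-trans (n<1+n u) u+1<) , v≤b (suc u) u+1< , vu<x , x<vu+1))

  ∈⇒onCell : ∀ {x} → x ∈ vs → OnCell D (a , b) x
  ∈⇒onCell x∈ with t , t<k , refl ← ∈⇒∈! x∈ = a≤v t t<k , v≤b t t<k , vertex-not-hidden t t<k

  cell≡cellOf : vs ≡ cellOf D (baseSide vs)
  cell≡cellOf = sorted-≡ (Increasing⇒AllPairs inc) (cellOf-sorted D (a , b))
                  (λ x∈ → ∈-cellOf⁺ (∈⇒onCell x∈)) (λ x∈ → onCell⇒∈ (∈-cellOf⁻ x∈))

  base-cellBase : CellBase n D (a , b)
  base-cellBase with subst (IsSide n D) (side-last vs last suc-last) (sides last last<k)
  ... | inj₂ base∈D = inj₁ base∈D
  ... | inj₁ (inj₂ (a≡0 , b≡n+1)) = inj₂ (cong₂ _,_ a≡0 b≡n+1)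
  ... | inj₁ (inj₁ b≡a+1) = ⊥-elim (1+n≰n (subst (suc (suc a) ≤_) b≡a+1 (subst (_≤ b) (+-comm a 2) a+2≤b)))

-- A cell is determined by any of its inner sides

span : Pt → ℕ
span (a , b) = b ∸ a

_⊏_ : Pt → Pt → Set
(c , d) ⊏ (a , b) = a ≤ c × d ≤ b × (c , d) ≢ (a , b)

_⊏?_ : ∀ r q → Dec (r ⊏ q)
(c , d) ⊏? (a , b) = (a ≤? c) ×-dec (d ≤? b) ×-dec ¬? ((c , d) ≟ᴾ (a , b))

module _ {n : ℕ} {D : List Pt} (dis : Dissection n D) where
  open Dissection dis

  private
    nested-bases-share-no-side : ∀ {vs ws} (Cv : Cell n D vs) (Cw : Cell n D ws) s t →
      suc s < length vs → suc t < length ws → vs ! s ≡ ws ! t → vs ! suc s ≡ ws ! suc t →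
      ¬ baseSide ws ⊏ baseSide vs
    nested-bases-share-no-side {vs} {ws} Cv Cw s t s+1< t+1< vs≡wt vs+1≡wt+1 (av≤aw , bw≤bv , bw≢bv)
      = cases (m≤n⇒m<n∨m≡n aw≤vs) (m≤n⇒m<n∨m≡n vs+1≤bw)
      where
      module V = CellFacts dis Cv
      module W = CellFacts dis Cw
      aw≤vs : W.a ≤ V.v s
      aw≤vs = subst (W.a ≤_) (sym vs≡wt) (W.a≤v t (<-trans (n<1+n t) t+1<))
      vs+1≤bw : V.v (suc s) ≤ W.b
      vs+1≤bw = subst (_≤ W.b) (sym vs+1≡wt+1) (W.v≤b (suc t) t+1<)
      base-w∈D : (W.a , W.b) ∈ D
      base-w∈D with W.base-cellBase
      ... | inj₁ base∈D = base∈D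
      ... | inj₂ base≡edge = ⊥-elim (bw≢bv (cong₂ _,_
                (trans (cong proj₁ base≡edge) (sym (n≤0⇒n≡0 (subst (V.a ≤_) (cong proj₁ base≡edge) av≤aw))))
                (trans (cong proj₂ base≡edge) (≤-antisym (subst (_≤ V.b) (cong proj₂ base≡edge) bw≤bv) V.b≤n+1))))
      cases : W.a < V.v s ⊎ W.a ≡ V.v s → V.v (suc s) < W.b ⊎ V.v (suc s) ≡ W.b → ⊥
      cases (inj₁ aw<vs) _ =
        V.vertex-not-hidden s (<-trans (n<1+n s) s+1<)
          (_ , base-w∈D , bw≢bv , av≤aw , bw≤bv , aw<vs , <-≤-trans (consecutive-< V.inc s s+1<) vs+1≤bw)
      cases (inj₂ aw≡vs) (inj₁ vs+1<bw) =
        V.vertex-not-hidden (suc s) s+1<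
          (_ , base-w∈D , bw≢bv , av≤aw , bw≤bv , subst (_< V.v (suc s)) (sym aw≡vs) (consecutive-< V.inc s s+1<) , vs+1<bw)
      cases (inj₂ aw≡vs) (inj₂ vs+1≡bw) =
        W.inner-side≢ t t+1< (cong₂ _,_ (trans (sym vs≡wt) (sym aw≡vs)) (trans (sym vs+1≡wt+1) vs+1≡bw))

    left-inside⇒right-inside : ∀ {vs ws} (Cv : Cell n D vs) (Cw : Cell n D ws) s t →
      suc s < length vs → suc t < length ws → vs ! s ≡ ws ! t →
      proj₁ (baseSide vs) < proj₁ (baseSide ws) → proj₂ (baseSide ws) ≤ proj₂ (baseSide vs)
    left-inside⇒right-inside {vs} {ws} Cv Cw s t s+1< t+1< vs≡wt av<aw =
      ≮⇒≥ (λ bv<bw → crossing bv<bw V.base-cellBase W.base-cellBase)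
      where
      module V = CellFacts dis Cv
      module W = CellFacts dis Cw
      aw<bv : W.a < V.b
      aw<bv = ≤-<-trans (subst (W.a ≤_) (sym vs≡wt) (W.a≤v t (<-trans (n<1+n t) t+1<)))
                        (<-≤-trans (consecutive-< V.inc s s+1<) (V.v≤b (suc s) s+1<))
      crossing : V.b < W.b → CellBase n D (V.a , V.b) → CellBase n D (W.a , W.b) → ⊥
      crossing bv<bw (inj₁ base-v∈D) (inj₁ base-w∈D) = nonCrossing _ _ base-v∈D base-w∈D (av<aw , aw<bv , bv<bw)
      crossing bv<bw (inj₂ e) _ = <⇒≱ bv<bw (subst (W.b ≤_) (sym (cong proj₂ e)) W.b≤n+1)
      crossing _ (inj₁ _) (inj₂ e) = n≮0 (subst (V.a <_) (cong proj₁ e) av<aw)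

  inner-side-determines-cell : ∀ {vs ws} (Cv : Cell n D vs) (Cw : Cell n D ws) s t →
    suc s < length vs → suc t < length ws → side vs s ≡ side ws t → vs ≡ ws × s ≡ t
  inner-side-determines-cell {vs} {ws} Cv Cw s t s+1< t+1< side≡ = vs≡ws , s≡t
    where
    module V = CellFacts dis Cv
    module W = CellFacts dis Cw
    vertices≡ : (V.v s , V.v (suc s)) ≡ (W.v t , W.v (suc t))
    vertices≡ = trans (sym (side-inner vs s s+1<)) (trans side≡ (side-inner ws t t+1<))
    vs≡wt = cong proj₁ vertices≡
    vs+1≡wt+1 = cong proj₂ vertices≡
    bases≡ : baseSide vs ≡ baseSide ws
    bases≡ with <-cmp V.a W.a
    ... | tri< av<aw _ _ = ⊥-elim (nested-bases-share-no-side Cv Cw s t s+1< t+1< vs≡wt vs+1≡wt+1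
            (<⇒≤ av<aw , left-inside⇒right-inside Cv Cw s t s+1< t+1< vs≡wt av<aw , λ e → <-irrefl (sym (cong proj₁ e)) av<aw))
    ... | tri> _ _ aw<av = ⊥-elim (nested-bases-share-no-side Cw Cv t s t+1< s+1< (sym vs≡wt) (sym vs+1≡wt+1)
            (<⇒≤ aw<av , left-inside⇒right-inside Cw Cv t s t+1< s+1< (sym vs≡wt) aw<av , λ e → <-irrefl (sym (cong proj₁ e)) aw<av))
    ... | tri≈ _ av≡aw _ with <-cmp V.b W.b
    ...   | tri< bv<bw _ _ = ⊥-elim (nested-bases-share-no-side Cw Cv t s t+1< s+1< (sym vs≡wt) (sym vs+1≡wt+1)
            (≤-reflexive (sym av≡aw) , <⇒≤ bv<bw , λ e → <-irrefl (cong proj₂ e) bv<bw))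
    ...   | tri> _ _ bw<bv = ⊥-elim (nested-bases-share-no-side Cv Cw s t s+1< t+1< vs≡wt vs+1≡wt+1
            (≤-reflexive av≡aw , <⇒≤ bw<bv , λ e → <-irrefl (cong proj₂ e) bw<bv))
    ...   | tri≈ _ bv≡bw _ = cong₂ _,_ av≡aw bv≡bw
    vs≡ws : vs ≡ ws
    vs≡ws = trans V.cell≡cellOf (trans (cong (cellOf D) bases≡) (sym W.cell≡cellOf))
    s≡t : s ≡ t
    s≡t = increasing-injective V.inc s t (<-trans (n<1+n s) s+1<)
            (subst (λ l → t < length l) (sym vs≡ws) (<-trans (n<1+n t) t+1<)) (trans vs≡wt (cong (_! t) (sym vs≡ws)))

  index<3 : ∀ {p c} → Index n D p c → c < 3
  index<3 base = s≤s z≤n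
  index<3 (step {c = c} {s = s} _ _ _) = m%n<n (c + s + 1) 3

  index-unique : ∀ {p p′ c c′} → Index n D p c → Index n D p′ c′ → p ≡ p′ → c ≡ c′
  index-unique base base _ = refl
  index-unique base (step {vs} {s = s} C _ s+1<) edge≡side =
    ⊥-elim (CellFacts.inner-side≢baseEdge dis C s s+1< (trans (sym (side-inner vs s s+1<)) (sym edge≡side)))
  index-unique (step {vs} {s = s} C _ s+1<) base side≡edge =
    ⊥-elim (CellFacts.inner-side≢baseEdge dis C s s+1< (trans (sym (side-inner vs s s+1<)) side≡edge))
  index-unique (step {vs} {c} {s} Cv i s+1<) (step {ws} {c′} {t} Cw i′ t+1<) side≡
    with refl , refl ← inner-side-determines-cell Cv Cw s t s+1< t+1< side≡ =
    cong (λ z → (z + s + 1) % 3) (index-unique i i′ refl)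

-- Chords bound cells and carry indices

module CellOfBase {n : ℕ} {D : List Pt} (dis : Dissection n D) (A B : ℕ)
                  (A+2≤B : A + 2 ≤ B) (B≤n+1 : B ≤ suc n) (AB-base : CellBase n D (A , B)) where
  open Dissection dis

  private
    On : ℕ → Set
    On = OnCell D (A , B)

  L : List ℕ
  L = cellOf D (A , B)

  inc : Increasing L
  inc = cellOf-increasing D (A , B)

  A<B : A < B
  A<B = <-≤-trans (subst (A <_) (+-comm 2 A) (m<n+m A (s≤s z≤n))) A+2≤B

  A-on : On A
  A-on = ≤-refl , <⇒≤ A<B , λ (_ , _ , _ , A≤c , _ , c<A , _) → <⇒≱ c<A A≤c

  B-on : On B
  B-on = <⇒≤ A<B , ≤-refl , λ (_ , _ , _ , _ , d≤B , _ , B<d) → <⇒≱ B<d d≤B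

  NothingBetween : ℕ → ℕ → Set
  NothingBetween x y = ∀ z → On z → ¬ (x < z × z < y)

  -- The vertex d is hidden by a chord, which must start at x and reach beyond d.
  extend : ∀ fuel x y d → On x → On y → x < d → d ≤ y → (x , d) ∈ D → (x , d) ≢ (A , B) →
           NothingBetween x y → y ≤ d + fuel → (x , y) ∈ D × (x , y) ≢ (A , B)
  extend fuel x y d x-on y-on x<d d≤y xd∈D xd≢AB nothing y≤d+fuel with m≤n⇒m<n∨m≡n d≤y
  ... | inj₂ refl = xd∈D , xd≢AB
  extend zero x y d x-on y-on x<d d≤y xd∈D xd≢AB nothing y≤d+fuel | inj₁ d<y =
    ⊥-elim (<⇒≱ d<y (subst (y ≤_) (+-identityʳ d) y≤d+fuel))
  extend (suc fuel) x y d x-on y-on x<d d≤y xd∈D xd≢AB nothing y≤d+fuel | inj₁ d<y =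
    longer (off⇒hidden (≤-trans (proj₁ x-on) (<⇒≤ x<d)) (≤-trans d≤y (proj₁ (proj₂ y-on)))
                          (λ d-on → nothing d d-on (x<d , d<y)))
    where
    longer : Hidden D (A , B) d → (x , y) ∈ D × (x , y) ≢ (A , B)
    longer ((c′ , d′) , c′d′∈D , c′d′≢AB , A≤c′ , d′≤B , c′<d , d<d′) with <-cmp c′ x
    ... | tri< c′<x _ _ = ⊥-elim (proj₂ (proj₂ x-on) (_ , c′d′∈D , c′d′≢AB , A≤c′ , d′≤B , c′<x , <-trans x<d d<d′))
    ... | tri> _ _ x<c′ = ⊥-elim (nonCrossing _ _ xd∈D c′d′∈D (x<c′ , c′<d , d<d′))
    ... | tri≈ _ refl _ with d′ ≤? y
    ...   | no d′≰y =
      ⊥-elim (proj₂ (proj₂ y-on) (_ , c′d′∈D , c′d′≢AB , A≤c′ , d′≤B , <-trans x<d d<y , ≰⇒> d′≰y))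
    ...   | yes d′≤y = extend fuel c′ y d′ x-on y-on (<-trans x<d d<d′) d′≤y c′d′∈D c′d′≢AB nothing
                         (≤-trans y≤d+fuel (subst (_≤ d′ + fuel) (sym (+-suc d fuel)) (+-monoˡ-≤ fuel d<d′)))

  consecutive-chord : ∀ x y → On x → On y → x < y → NothingBetween x y → y ≢ suc x →
                      (x , y) ∈ D × (x , y) ≢ (A , B)
  consecutive-chord x y x-on y-on x<y nothing y≢x+1 =
    first-chord (off⇒hidden (≤-trans (proj₁ x-on) (n≤1+n x)) (≤-trans x<y (proj₁ (proj₂ y-on)))
                                (λ x+1-on → nothing (suc x) x+1-on (≤-refl , x+1<y)))
    where
    x+1<y : suc x < y
    x+1<y with m≤n⇒m<n∨m≡n x<y
    ... | inj₁ x+1<y = x+1<y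
    ... | inj₂ x+1≡y = ⊥-elim (y≢x+1 (sym x+1≡y))
    first-chord : Hidden D (A , B) (suc x) → (x , y) ∈ D × (x , y) ≢ (A , B)
    first-chord ((c , d) , cd∈D , cd≢AB , A≤c , d≤B , c<x+1 , x+1<d) with m≤n⇒m<n∨m≡n (≤-pred c<x+1)
    ... | inj₁ c<x = ⊥-elim (proj₂ (proj₂ x-on) (_ , cd∈D , cd≢AB , A≤c , d≤B , c<x , <-trans (n<1+n x) x+1<d))
    ... | inj₂ refl with d ≤? y
    ...   | no d≰y = ⊥-elim (proj₂ (proj₂ y-on) (_ , cd∈D , cd≢AB , A≤c , d≤B , x<y , ≰⇒> d≰y))
    ...   | yes d≤y = extend y c y d x-on y-on (<-trans (n<1+n c) x+1<d) d≤y cd∈D cd≢AB nothing (m≤n+m y d)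

  on-L : ∀ t → t < length L → On (L ! t)
  on-L t t< = ∈-cellOf⁻ (!-∈ t<)

  position : ∀ {x} → On x → x ∈! L
  position x-on = ∈⇒∈! (∈-cellOf⁺ x-on)

  last : ℕ
  last = length L ∸ 1

  0<len : 0 < length L
  0<len with t , t< , _ ← position A-on = ≤-<-trans z≤n t<

  suc-last : suc last ≡ length L
  suc-last = m+[n∸m]≡n 0<len

  last<len : last < length L
  last<len = subst (last <_) suc-last ≤-refl

  L!0≡A : L ! 0 ≡ A
  L!0≡A with t , t< , L!t≡A ← position A-on =
    ≤-antisym (subst (L ! 0 ≤_) L!t≡A (increasing-≤ inc 0 t z≤n t<)) (proj₁ (on-L 0 0<len))

  L!last≡B : L ! last ≡ B
  L!last≡B with t , t< , L!t≡B ← position B-on =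
    ≤-antisym (proj₁ (proj₂ (on-L last last<len)))
              (subst (_≤ L ! last) L!t≡B (increasing-≤ inc t last (≤-pred (subst (t <_) (sym suc-last) t<)) last<len))

  nothing-between-consecutive : ∀ s → suc s < length L → NothingBetween (L ! s) (L ! suc s)
  nothing-between-consecutive s s+1< z z-on (Ls<z , z<Ls+1) with t , t< , refl ← position z-on =
    <-irrefl refl (<-≤-trans (increasing-cancel-< inc s t (<-trans (n<1+n s) s+1<) Ls<z)
                             (≤-pred (increasing-cancel-< inc t (suc s) t< z<Ls+1)))

  baseSide-cellOf : baseSide L ≡ (A , B)
  baseSide-cellOf = cong₂ _,_ L!0≡A L!last≡B

  B≢A+1 : B ≢ suc A
  B≢A+1 B≡A+1 = 1+n≰n (subst (suc (suc A) ≤_) B≡A+1 (subst (_≤ B) (+-comm A 2) A+2≤B))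

  3≤len : 3 ≤ length L
  3≤len = subst (3 ≤_) suc-last (s≤s (≮⇒≥ (too-short last refl)))
    where
    too-short : ∀ l → l ≡ last → l < 2 → ⊥
    too-short zero l≡last _ = <-irrefl (trans (sym L!0≡A) (trans (cong (L !_) l≡last) L!last≡B)) A<B
    too-short (suc zero) l≡last _ =
      proj₂ (consecutive-chord A B A-on B-on A<B nothing B≢A+1) refl
      where
      nothing : NothingBetween A B
      nothing = subst₂ NothingBetween L!0≡A (trans (cong (L !_) l≡last) L!last≡B)
                  (nothing-between-consecutive 0 (subst (1 <_) (trans (cong suc l≡last) suc-last) ≤-refl))
    too-short (suc (suc _)) _ (s≤s (s≤s ()))

  sides-L : ∀ s → s < length L → IsSide n D (side L s)
  sides-L s s< with suc s <? length L
  ... | yes s+1< = subst (IsSide n D) (sym (side-inner L s s+1<)) inner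
    where
    inner : IsSide n D (L ! s , L ! suc s)
    inner with L ! suc s ≟ suc (L ! s)
    ... | yes edge = inj₁ (inj₁ edge)
    ... | no not-edge = inj₂ (proj₁ (consecutive-chord _ _ (on-L s s<) (on-L (suc s) s+1<)
                               (consecutive-< inc s s+1<) (nothing-between-consecutive s s+1<) not-edge))
  ... | no s+1≮ = subst (IsSide n D) (sym (trans (side-last L s s+1≡len) (cong₂ _,_ L!0≡A L!s≡B))) base-side
    where
    s+1≡len : suc s ≡ length L
    s+1≡len = ≤-antisym s< (≮⇒≥ s+1≮)
    L!s≡B : L ! s ≡ B
    L!s≡B = trans (cong (L !_) (suc-injective (trans s+1≡len (sym suc-last)))) L!last≡B
    base-side : IsSide n D (A , B)
    base-side = [ inj₂ , (λ e → inj₁ (inj₂ (cong proj₁ e , cong proj₂ e))) ]′ AB-base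

  empty-L : ∀ s t → s < t → t < length L → t ≢ suc s → ¬ ((s ≡ 0) × (suc t ≡ length L)) → (L ! s , L ! t) ∉ D
  empty-L s t s<t t< t≢s+1 not-base st∈D =
    proj₂ (proj₂ (on-L (suc s) s+1<))
      (_ , st∈D , st≢AB , proj₁ (on-L s s<) , proj₁ (proj₂ (on-L t t<)) ,
       consecutive-< inc s s+1< , increasing-< inc (suc s) t s+1<t t<)
    where
    s+1<t : suc s < t
    s+1<t with m≤n⇒m<n∨m≡n s<t
    ... | inj₁ s+1<t = s+1<t
    ... | inj₂ s+1≡t = ⊥-elim (t≢s+1 (sym s+1≡t))
    s+1< = <-trans s+1<t t<
    s< = <-trans s<t t<
    st≢AB : (L ! s , L ! t) ≢ (A , B)
    st≢AB e = not-base (increasing-injective inc s 0 s< 0<len (trans (cong proj₁ e) (sym L!0≡A)) ,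
                        trans (cong suc (increasing-injective inc t last t< last<len (trans (cong proj₂ e) (sym L!last≡B))))
                              suc-last)

  cellOf-cell : Cell n D L
  cellOf-cell = record
    { atLeast3 = 3≤len
    ; inRange = λ s s< → ≤-trans (proj₁ (proj₂ (on-L s s<))) B≤n+1
    ; increasing = consecutive-< inc
    ; sides = sides-L
    ; empty = empty-L
    }

span-⊏ : ∀ {r q} → r ⊏ q → proj₁ r ≤ proj₂ r → proj₁ r ≤ proj₂ q → span r < span q
span-⊏ {r₁ , r₂} {q₁ , q₂} (q₁≤r₁ , r₂≤q₂ , r≢q) r₁≤r₂ r₁≤q₂ with m≤n⇒m<n∨m≡n q₁≤r₁
... | inj₁ q₁<r₁ = ≤-<-trans (∸-monoˡ-≤ r₁ r₂≤q₂) (∸-monoʳ-< q₁<r₁ r₁≤q₂)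
... | inj₂ refl with m≤n⇒m<n∨m≡n r₂≤q₂
...   | inj₁ r₂<q₂ = ∸-monoˡ-< r₂<q₂ r₁≤r₂
...   | inj₂ refl = ⊥-elim (r≢q refl)

module _ {n : ℕ} {D : List Pt} (dis : Dissection n D) (1≤n : 1 ≤ n) where
  open Dissection dis

  cellBase-bounds : ∀ {A B} → CellBase n D (A , B) → A + 2 ≤ B × B ≤ suc n
  cellBase-bounds (inj₁ AB∈D) = let (A+2≤B , B≤n+1 , _) = chords _ AB∈D in A+2≤B , B≤n+1
  cellBase-bounds (inj₂ refl) = s≤s 1≤n , ≤-refl

  cellOf-isCell : ∀ A B → CellBase n D (A , B) → Cell n D (cellOf D (A , B)) × baseSide (cellOf D (A , B)) ≡ (A , B)
  cellOf-isCell A B AB-base = E.cellOf-cell , E.baseSide-cellOf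
    where module E = CellOfBase dis A B (proj₁ (cellBase-bounds AB-base)) (proj₂ (cellBase-bounds AB-base)) AB-base

  depth : Pt → ℕ
  depth (a , b) = a + (suc n ∸ b)

  depth-⊏ : ∀ {r q} → r ⊏ q → proj₂ q ≤ suc n → depth q < depth r
  depth-⊏ {r₁ , r₂} {q₁ , q₂} (q₁≤r₁ , r₂≤q₂ , r≢q) q₂≤n+1 with m≤n⇒m<n∨m≡n q₁≤r₁
  ... | inj₁ q₁<r₁ = +-mono-<-≤ q₁<r₁ (∸-monoʳ-≤ (suc n) r₂≤q₂)
  ... | inj₂ refl with m≤n⇒m<n∨m≡n r₂≤q₂
  ...   | inj₁ r₂<q₂ = +-monoʳ-< q₁ (∸-monoʳ-< r₂<q₂ q₂≤n+1)
  ...   | inj₂ refl = ⊥-elim (r≢q refl)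

  Innermost : Pt → Pt → Set
  Innermost q p = CellBase n D q × p ⊏ q × (∀ r → r ∈ D → r ⊏ q → ¬ p ⊏ r)

  innermost-around : ∀ fuel p q → CellBase n D q → p ⊏ q → proj₁ p ≤ proj₂ p → span q < fuel →
                     ∃ λ q′ → Innermost q′ p
  innermost-around (suc fuel) p q q-base p⊏q p₁≤p₂ span<fuel with ∃∈? (λ r → (r ⊏? q) ×-dec (p ⊏? r)) D
  ... | no none = q , q-base , p⊏q , λ r r∈D r⊏q p⊏r → none (r , r∈D , r⊏q , p⊏r)
  ... | yes (r , r∈D , r⊏q , p⊏r) =
    innermost-around fuel p r (inj₁ r∈D) p⊏r p₁≤p₂ (<-≤-trans (span-⊏ r⊏q r₁≤r₂ r₁≤q₂) (≤-pred span<fuel))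
    where
    r₁≤r₂ = ≤-trans (proj₁ p⊏r) (≤-trans p₁≤p₂ (proj₁ (proj₂ p⊏r)))
    r₁≤q₂ = ≤-trans r₁≤r₂ (proj₁ (proj₂ r⊏q))

  innermost-side : ∀ A B a b → (a , b) ∈ D → Innermost (A , B) (a , b) →
                   ∃ λ t → suc t < length (cellOf D (A , B)) × side (cellOf D (A , B)) t ≡ (a , b)
  innermost-side A B a b ab∈D (AB-base , (A≤a , b≤B , ab≢AB) , innermost) =
    ta , ta+1< , trans (side-inner L ta ta+1<) (cong₂ _,_ L!ta≡a (trans (cong (L !_) ta+1≡tb) L!tb≡b))
    where
    module E = CellOfBase dis A B (proj₁ (cellBase-bounds AB-base)) (proj₂ (cellBase-bounds AB-base)) AB-base
    L = E.L
    a<b : a < b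
    a<b = <-≤-trans (subst (a <_) (+-comm 2 a) (m<n+m a (s≤s z≤n))) (proj₁ (chords _ ab∈D))
    a-on : OnCell D (A , B) a
    a-on = A≤a , ≤-trans (<⇒≤ a<b) b≤B , not-hidden
      where
      not-hidden : ¬ Hidden D (A , B) a
      not-hidden ((c , d) , cd∈D , cd≢AB , A≤c , d≤B , c<a , a<d) with d <? b
      ... | yes d<b = nonCrossing _ _ cd∈D ab∈D (c<a , a<d , d<b)
      ... | no d≮b = innermost (c , d) cd∈D (A≤c , d≤B , cd≢AB)
                       (<⇒≤ c<a , ≮⇒≥ d≮b , λ e → <-irrefl (sym (cong proj₁ e)) c<a)
    b-on : OnCell D (A , B) b
    b-on = ≤-trans A≤a (<⇒≤ a<b) , b≤B , not-hidden
      where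
      not-hidden : ¬ Hidden D (A , B) b
      not-hidden ((c , d) , cd∈D , cd≢AB , A≤c , d≤B , c<b , b<d) with a <? c
      ... | yes a<c = nonCrossing _ _ ab∈D cd∈D (a<c , c<b , b<d)
      ... | no a≮c = innermost (c , d) cd∈D (A≤c , d≤B , cd≢AB)
                       (≮⇒≥ a≮c , <⇒≤ b<d , λ e → <-irrefl (cong proj₂ e) b<d)
    ta = proj₁ (E.position a-on)
    ta< = proj₁ (proj₂ (E.position a-on))
    L!ta≡a = proj₂ (proj₂ (E.position a-on))
    tb = proj₁ (E.position b-on)
    tb< = proj₁ (proj₂ (E.position b-on))
    L!tb≡b = proj₂ (proj₂ (E.position b-on))
    ta+1≡tb : suc ta ≡ tb
    ta+1≡tb with m≤n⇒m<n∨m≡n (increasing-cancel-< E.inc ta tb ta< (subst₂ _<_ (sym L!ta≡a) (sym L!tb≡b) a<b))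
    ... | inj₂ ta+1≡tb = ta+1≡tb
    ... | inj₁ ta+1<tb = ⊥-elim (proj₂ (proj₂ (E.on-L (suc ta) ta+1<)) ((a , b) , ab∈D , ab≢AB , A≤a , b≤B ,
            subst (_< L ! suc ta) L!ta≡a (consecutive-< E.inc ta ta+1<) ,
            subst (L ! suc ta <_) L!tb≡b (increasing-< E.inc (suc ta) tb ta+1<tb tb<)))
      where ta+1< = <-trans ta+1<tb tb<
    ta+1< : suc ta < length L
    ta+1< = subst (_< length L) (sym ta+1≡tb) tb<

  index-exists : ∀ fuel p → CellBase n D p → depth p < fuel → ∃ λ c → Index n D p c
  index-exists (suc fuel) p (inj₂ refl) _ = 0 , base
  index-exists (suc fuel) (a , b) (inj₁ ab∈D) depth<fuel =
    (c + t + 1) % 3 , subst (λ p → Index n D p ((c + t + 1) % 3)) side≡ab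
                        (step cell (subst (λ p → Index n D p c) (sym base≡q) idx) t+1<)
    where
    a+2≤b = proj₁ (chords _ ab∈D)
    ab⊏edge : (a , b) ⊏ baseEdge n
    ab⊏edge = z≤n , proj₁ (proj₂ (chords _ ab∈D)) , λ e → proj₂ (proj₂ (chords _ ab∈D)) (cong proj₁ e , cong proj₂ e)
    around = innermost-around (suc (suc n)) (a , b) (baseEdge n) (inj₂ refl) ab⊏edge
               (≤-trans (m≤m+n a 2) a+2≤b) (n<1+n (suc n))
    q = proj₁ around
    q-innermost = proj₂ around
    q-base = proj₁ q-innermost
    cell = proj₁ (cellOf-isCell (proj₁ q) (proj₂ q) q-base)
    base≡q = proj₂ (cellOf-isCell (proj₁ q) (proj₂ q) q-base)
    on-side = innermost-side (proj₁ q) (proj₂ q) a b ab∈D q-innermost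
    t = proj₁ on-side
    t+1< = proj₁ (proj₂ on-side)
    side≡ab = proj₂ (proj₂ on-side)
    outer = index-exists fuel q q-base
              (<-≤-trans (depth-⊏ (proj₁ (proj₂ q-innermost)) (proj₂ (cellBase-bounds q-base))) (≤-pred depth<fuel))
    c = proj₁ outer
    idx = proj₂ outer

  index-of : ∀ p → CellBase n D p → ∃ λ c → Index n D p c
  index-of p p-base = index-exists (suc (depth p)) p p-base ≤-refl

-- Where a chord lies relative to a cell

chord-< : ∀ {n c d} → IsChord n (c , d) → c < d
chord-< {c = c} (c+2≤d , _) = <-≤-trans (subst (c <_) (+-comm 2 c) (m<n+m c (s≤s z≤n))) c+2≤d

module ChordPlacement {n : ℕ} {D : List Pt} {vs : List ℕ} (dis : Dissection n D) (C : Cell n D vs) where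
  open Dissection dis
  open CellFacts dis C

  base-uncrossed : ∀ c d → (c , d) ∈ D → ¬ Cross (a , b) (c , d) × ¬ Cross (c , d) (a , b)
  base-uncrossed c d cd∈D with base-cellBase
  ... | inj₁ ab∈D = nonCrossing _ _ ab∈D cd∈D , nonCrossing _ _ cd∈D ab∈D
  ... | inj₂ ab≡edge =
    (λ (_ , _ , b<d) → <⇒≱ (subst (_< d) (cong proj₂ ab≡edge) b<d) (proj₁ (proj₂ (chords _ cd∈D)))) ,
    (λ (c<a , _ , _) → n≮0 (subst (c <_) (cong proj₁ ab≡edge) c<a))

  data Placement : Pt → Set where
    left   : ∀ {c d} → d ≤ a → Placement (c , d)
    right  : ∀ {c d} → b ≤ c → Placement (c , d)
    around : ∀ {c d} → c ≤ a → b ≤ d → Placement (c , d)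
    in-gap : ∀ {c d} u → suc u < k → v u ≤ c → d ≤ v (suc u) → Placement (c , d)

  placement-inside : ∀ c d → (c , d) ∈ D → a ≤ c → d ≤ b → Placement (c , d)
  placement-inside c d cd∈D a≤c d≤b with (c , d) ≟ᴾ (a , b)
  ... | yes refl = around ≤-refl ≤-refl
  ... | no cd≢ab with gap< c a≤c (<-≤-trans (chord-< (chords _ cd∈D)) d≤b)
  ...   | u , u+1< , vu≤c , c<vu+1 with d ≤? v (suc u)
  ...     | yes d≤vu+1 = in-gap u u+1< vu≤c d≤vu+1
  ...     | no d≰vu+1 =
    ⊥-elim (vertex-not-hidden (suc u) u+1< (_ , cd∈D , cd≢ab , a≤c , d≤b , c<vu+1 , ≰⇒> d≰vu+1))

  placement : ∀ c d → (c , d) ∈ D → Placement (c , d)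
  placement c d cd∈D with d ≤? a | b ≤? c
  ... | yes d≤a | _ = left d≤a
  ... | no _ | yes b≤c = right b≤c
  ... | no d≰a | no b≰c with c ≤? a | b ≤? d
  ...   | yes c≤a | yes b≤d = around c≤a b≤d
  ...   | yes c≤a | no b≰d with m≤n⇒m<n∨m≡n c≤a
  ...     | inj₁ c<a = ⊥-elim (proj₂ (base-uncrossed c d cd∈D) (c<a , ≰⇒> d≰a , ≰⇒> b≰d))
  ...     | inj₂ c≡a = placement-inside c d cd∈D (≤-reflexive (sym c≡a)) (<⇒≤ (≰⇒> b≰d))
  placement c d cd∈D | no d≰a | no b≰c | no c≰a | yes b≤d with m≤n⇒m<n∨m≡n b≤d
  ... | inj₁ b<d = ⊥-elim (proj₁ (base-uncrossed c d cd∈D) (≰⇒> c≰a , ≰⇒> b≰c , b<d))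
  ... | inj₂ b≡d = placement-inside c d cd∈D (<⇒≤ (≰⇒> c≰a)) (≤-reflexive (sym b≡d))
  placement c d cd∈D | no d≰a | no b≰c | no c≰a | no b≰d =
    placement-inside c d cd∈D (<⇒≤ (≰⇒> c≰a)) (<⇒≤ (≰⇒> b≰d))

  no-vertex-in-gap : ∀ u t → suc u < k → t < k → v u < v t → v t < v (suc u) → ⊥
  no-vertex-in-gap u t u+1< t<k vu<vt vt<vu+1 =
    <⇒≱ (increasing-cancel-< inc u t (<-trans (n<1+n u) u+1<) vu<vt)
        (≤-pred (increasing-cancel-< inc t (suc u) t<k vt<vu+1))

  vertex-chord-uncrossed : ∀ i j → i < j → j < k → ∀ c d → (c , d) ∈ D →
                           ¬ Cross (v i , v j) (c , d) × ¬ Cross (c , d) (v i , v j)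
  vertex-chord-uncrossed i j i<j j<k c d cd∈D = outer (placement c d cd∈D) , inner (placement c d cd∈D)
    where
    i<k = <-trans i<j j<k
    outer : Placement (c , d) → ¬ Cross (v i , v j) (c , d)
    outer (left d≤a) (vi<c , _ , _) = <⇒≱ (<-trans vi<c (chord-< (chords _ cd∈D))) (≤-trans d≤a (a≤v i i<k))
    outer (right b≤c) (_ , c<vj , _) = <⇒≱ c<vj (≤-trans (v≤b j j<k) b≤c)
    outer (around c≤a _) (vi<c , _ , _) = <⇒≱ vi<c (≤-trans c≤a (a≤v i i<k))
    outer (in-gap u u+1< vu≤c d≤vu+1) (_ , c<vj , vj<d) =
      no-vertex-in-gap u j u+1< j<k (≤-<-trans vu≤c c<vj) (<-≤-trans vj<d d≤vu+1)
    inner : Placement (c , d) → ¬ Cross (c , d) (v i , v j)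
    inner (left d≤a) (_ , vi<d , _) = <⇒≱ vi<d (≤-trans d≤a (a≤v i i<k))
    inner (right b≤c) (c<vi , _ , _) = <⇒≱ c<vi (≤-trans (v≤b i i<k) b≤c)
    inner (around _ b≤d) (_ , _ , d<vj) = <⇒≱ d<vj (≤-trans (v≤b j j<k) b≤d)
    inner (in-gap u u+1< vu≤c d≤vu+1) (c<vi , vi<d , _) =
      no-vertex-in-gap u i u+1< i<k (≤-<-trans vu≤c c<vi) (<-≤-trans vi<d d≤vu+1)

-- Opening surgery

_without_ : List Pt → Pt → List Pt
D without x = filter (λ p → ¬? (p ≟ᴾ x)) D

∈-without⁻ : ∀ {D x p} → p ∈ D without x → p ∈ D × p ≢ x
∈-without⁻ {D} {x} = ∈-filter⁻ (λ p → ¬? (p ≟ᴾ x))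

∈-without⁺ : ∀ {D x p} → p ∈ D → p ≢ x → p ∈ D without x
∈-without⁺ {D} {x} = ∈-filter⁺ (λ p → ¬? (p ≟ᴾ x))

spanSum : List Pt → ℕ
spanSum D = sum (map span D)

spanSum-without : ∀ {x} D → x ∈ D → spanSum (D without x) + span x ≤ spanSum D
spanSum-without {x} (p ∷ D) p∈ with p ≟ᴾ x | p∈
... | yes refl | _ = ≤-trans (≤-reflexive (+-comm (spanSum (D without p)) (span p))) (+-monoʳ-≤ (span p) (without-≤ D))
  where
  without-≤ : ∀ D → spanSum (D without x) ≤ spanSum D
  without-≤ [] = ≤-refl
  without-≤ (q ∷ D) with q ≟ᴾ x
  ... | yes _ = ≤-trans (without-≤ D) (m≤n+m _ (span q))
  ... | no _ = +-monoʳ-≤ (span q) (without-≤ D)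
... | no p≢x | here refl = ⊥-elim (p≢x refl)
... | no _ | there x∈D = ≤-trans (≤-reflexive (+-assoc (span p) _ _)) (+-monoʳ-≤ (span p) (spanSum-without D x∈D))

span-split : ∀ a p q b → a ≤ p → p < q → q ≤ b → span (a , p) + span (q , b) < span (p , q) + span (a , b)
span-split a p q b a≤p p<q q≤b with m≤n⇒∃[o]m+o≡n a≤p | m≤n⇒∃[o]m+o≡n p<q | m≤n⇒∃[o]m+o≡n q≤b
... | x , refl | y , refl | z , refl =
  subst₂ _<_ (sym (cong₂ _+_ (m+n∸m≡n a x) (m+n∸m≡n (suc (a + x) + y) z))) (sym (cong₂ _+_ q∸p b∸a)) x+z<
  where
  q∸p : suc (a + x) + y ∸ (a + x) ≡ suc y
  q∸p = trans (cong (_∸ (a + x)) (sym (+-suc (a + x) y))) (m+n∸m≡n (a + x) (suc y))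
  b∸a : suc (a + x) + y + z ∸ a ≡ x + suc y + z
  b∸a = trans (cong (_∸ a) b≡) (m+n∸m≡n a (x + suc y + z))
    where
    b≡ : suc (a + x) + y + z ≡ a + (x + suc y + z)
    b≡ = trans (cong (_+ z) (sym (+-suc (a + x) y)))
               (trans (cong (_+ z) (+-assoc a x (suc y))) (+-assoc a (x + suc y) z))
  x+z< : x + z < suc y + (x + suc y + z)
  x+z< = s≤s (≤-trans (+-monoˡ-≤ z (m≤m+n x (suc y))) (m≤n+m (x + suc y + z) y))

module Surgery {n : ℕ} {D : List Pt} {vs : List ℕ} (dis : Dissection n D) (C : Cell n D vs)
               (s : ℕ) (2≤s : 2 ≤ s) (s+4≤k : s + 4 ≤ length vs)
               (side∈D : side vs s ∈ D) (base∈D : baseSide vs ∈ D) where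
  open Dissection dis
  open CellFacts dis C
  open ChordPlacement dis C

  s+3≤last : s + 3 ≤ last
  s+3≤last = ≤-pred (subst₂ _≤_ (+-suc s 3) (sym suc-last) s+4≤k)

  s+2<last : suc (suc s) < last
  s+2<last = ≤-trans (≤-reflexive (+-comm 3 s)) s+3≤last

  s+1<last : suc s < last
  s+1<last = <-trans (n<1+n (suc s)) s+2<last

  s<last : s < last
  s<last = <-trans (n<1+n s) s+1<last

  s+1<k : suc s < k
  s+1<k = <-trans s+1<last last<k

  s<k : s < k
  s<k = <-trans (n<1+n s) s+1<k

  0<s : 0 < s
  0<s = ≤-trans (s≤s z≤n) 2≤s

  S B L R : Pt
  S = (v s , v (suc s))
  B = (a , b)
  L = (a , v s)
  R = (v (suc s) , b)

  side≡S : side vs s ≡ S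
  side≡S = side-inner vs s s+1<k

  side≡B : side vs last ≡ B
  side≡B = side-last vs last suc-last

  S∈D : S ∈ D
  S∈D = subst (_∈ D) side≡S side∈D

  a<vs : a < v s
  a<vs = increasing-< inc 0 s 0<s s<k

  vs<vs+1 : v s < v (suc s)
  vs<vs+1 = consecutive-< inc s s+1<k

  vs+1<b : v (suc s) < b
  vs+1<b = increasing-< inc (suc s) last s+1<last last<k

  vs<b : v s < b
  vs<b = <-trans vs<vs+1 vs+1<b

  a<b : a < b
  a<b = <-trans a<vs vs<b

  a<vs+1 : a < v (suc s)
  a<vs+1 = <-trans a<vs vs<vs+1

  D′ : List Pt
  D′ = L ∷ R ∷ (D without S) without B

  ∈D′⁻ : ∀ {p} → p ∈ D′ → p ≡ L ⊎ p ≡ R ⊎ (p ∈ D × p ≢ S × p ≢ B)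
  ∈D′⁻ (here refl) = inj₁ refl
  ∈D′⁻ (there (here refl)) = inj₂ (inj₁ refl)
  ∈D′⁻ (there (there p∈)) with p∈D∖S , p≢B ← ∈-without⁻ p∈ with p∈D , p≢S ← ∈-without⁻ p∈D∖S =
    inj₂ (inj₂ (p∈D , p≢S , p≢B))

  ∈D′⁺ : ∀ {p} → p ∈ D → p ≢ S → p ≢ B → p ∈ D′
  ∈D′⁺ p∈D p≢S p≢B = there (there (∈-without⁺ (∈-without⁺ p∈D p≢S) p≢B))

  L∈D′ : L ∈ D′
  L∈D′ = here refl

  R∈D′ : R ∈ D′
  R∈D′ = there (here refl)

  vtx-inner : ∀ t → t < k → vtx vs t ≡ v t
  vtx-inner t t<k rewrite <ᵇ-true t<k = refl

  vtx-k : vtx vs k ≡ a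
  vtx-k rewrite <ᵇ-false {k} {k} (<-irrefl refl) = refl

  chordOf-< : ∀ {x y} → x < y → chordOf x y ≡ (x , y)
  chordOf-< x<y = cong₂ _,_ (m≤n⇒m⊓n≡m (<⇒≤ x<y)) (m≤n⇒m⊔n≡n (<⇒≤ x<y))

  newChord₁≡R : newChord₁ vs s last ≡ R
  newChord₁≡R = trans (cong₂ chordOf (vtx-inner (suc s) s+1<k) (vtx-inner last last<k)) (chordOf-< vs+1<b)

  newChord₂≡L : newChord₂ vs s last ≡ L
  newChord₂≡L = trans (cong₂ chordOf (trans (cong (vtx vs) suc-last) vtx-k) (vtx-inner s s<k)) (chordOf-< a<vs)

  surgery-result : SurgeryResult D vs s last D′
  surgery-result p = (λ p∈ → to (∈D′⁻ p∈)) , from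
    where
    to : p ≡ L ⊎ p ≡ R ⊎ (p ∈ D × p ≢ S × p ≢ B) → _
    to (inj₁ p≡L) = inj₂ (inj₂ (trans p≡L (sym newChord₂≡L)))
    to (inj₂ (inj₁ p≡R)) = inj₂ (inj₁ (trans p≡R (sym newChord₁≡R)))
    to (inj₂ (inj₂ (p∈D , p≢S , p≢B))) = inj₁ (p∈D , (λ e → p≢S (trans e side≡S)) , (λ e → p≢B (trans e side≡B)))
    from : _ → p ∈ D′
    from (inj₁ (p∈D , p≢side , p≢base)) =
      ∈D′⁺ p∈D (λ e → p≢side (trans e (sym side≡S))) (λ e → p≢base (trans e (sym side≡B)))
    from (inj₂ (inj₁ refl)) = subst (_∈ D′) (sym newChord₁≡R) R∈D′
    from (inj₂ (inj₂ refl)) = subst (_∈ D′) (sym newChord₂≡L) L∈D′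

  L∉D : L ∉ D
  L∉D = Cell.empty C 0 s 0<s s<k (λ s≡1 → <-irrefl (sym s≡1) 2≤s) (λ (_ , s+1≡k) → <-irrefl s+1≡k s+1<k)

  R∉D : R ∉ D
  R∉D = Cell.empty C (suc s) last s+1<last last<k (λ last≡s+2 → <-irrefl (sym last≡s+2) s+2<last) (λ (s+1≡0 , _) → 1+n≢0 s+1≡0)

  L-chord : IsChord n L
  L-chord = subst (_≤ v s) (+-comm 2 a) (≤-trans (s≤s (increasing-< inc 0 1 (s≤s z≤n) 1<k)) (increasing-< inc 1 s 2≤s s<k)) ,
            ≤-trans (<⇒≤ vs<b) b≤n+1 ,
            λ (_ , vs≡n+1) → <⇒≱ (subst (_< b) vs≡n+1 vs<b) b≤n+1

  R-chord : IsChord n R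
  R-chord = subst (_≤ b) (+-comm 2 (v (suc s)))
              (≤-trans (s≤s (consecutive-< inc (suc s) (<-trans s+2<last last<k))) (increasing-< inc (suc (suc s)) last s+2<last last<k)) ,
            b≤n+1 ,
            λ (vs+1≡0 , _) → n≮0 (subst (a <_) vs+1≡0 a<vs+1)

  dissection′ : Dissection n D′
  dissection′ = record { chords = chords′ ; nonCrossing = nonCrossing′ }
    where
    chords′ : ∀ p → p ∈ D′ → IsChord n p
    chords′ p p∈ with ∈D′⁻ p∈
    ... | inj₁ refl = L-chord
    ... | inj₂ (inj₁ refl) = R-chord
    ... | inj₂ (inj₂ (p∈D , _)) = chords p p∈D
    L-uncrossed = vertex-chord-uncrossed 0 s 0<s s<k
    R-uncrossed = vertex-chord-uncrossed (suc s) last s+1<last last<k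
    irreflexive : ∀ p → ¬ Cross p p
    irreflexive p (x<x , _ , _) = <-irrefl refl x<x
    nonCrossing′ : ∀ p q → p ∈ D′ → q ∈ D′ → ¬ Cross p q
    nonCrossing′ p q p∈ q∈ with ∈D′⁻ p∈ | ∈D′⁻ q∈
    ... | inj₁ refl | inj₁ refl = irreflexive L
    ... | inj₁ refl | inj₂ (inj₁ refl) = λ (_ , vs+1<vs , _) → <-asym vs+1<vs vs<vs+1
    ... | inj₁ refl | inj₂ (inj₂ (q∈D , _)) = proj₁ (L-uncrossed _ _ q∈D)
    ... | inj₂ (inj₁ refl) | inj₁ refl = λ (vs+1<a , _ , _) → <-asym vs+1<a a<vs+1
    ... | inj₂ (inj₁ refl) | inj₂ (inj₁ refl) = irreflexive R
    ... | inj₂ (inj₁ refl) | inj₂ (inj₂ (q∈D , _)) = proj₁ (R-uncrossed _ _ q∈D)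
    ... | inj₂ (inj₂ (p∈D , _)) | inj₁ refl = proj₂ (L-uncrossed _ _ p∈D)
    ... | inj₂ (inj₂ (p∈D , _)) | inj₂ (inj₁ refl) = proj₂ (R-uncrossed _ _ p∈D)
    ... | inj₂ (inj₂ (p∈D , _)) | inj₂ (inj₂ (q∈D , _)) = nonCrossing p q p∈D q∈D

  spanSum-decreases : spanSum D′ < spanSum D
  spanSum-decreases = begin-strict
    spanSum D′                           ≡⟨ +-assoc (span L) (span R) rest ⟨
    (span L + span R) + rest             <⟨ +-monoˡ-< rest (span-split a (v s) (v (suc s)) b (<⇒≤ a<vs) vs<vs+1 (<⇒≤ vs+1<b)) ⟩
    (span S + span B) + rest             ≡⟨ rearrange (span S) (span B) rest ⟩
    (rest + span B) + span S             ≤⟨ +-monoˡ-≤ (span S) (spanSum-without (D without S) (∈-without⁺ B∈D B≢S)) ⟩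
    spanSum (D without S) + span S       ≤⟨ spanSum-without D S∈D ⟩
    spanSum D                            ∎
    where
    open ≤-Reasoning
    rest = spanSum ((D without S) without B)
    B∈D : B ∈ D
    B∈D = base∈D
    B≢S : B ≢ S
    B≢S B≡S = <-irrefl (cong proj₁ B≡S) a<vs
    rearrange : ∀ x y z → (x + y) + z ≡ (z + y) + x
    rearrange x y z = trans (+-comm (x + y) z) (trans (cong (z +_) (+-comm x y)) (sym (+-assoc z y x)))

-- The cells after an opening surgery

module SurgeryCells {n : ℕ} {D : List Pt} {vs : List ℕ} (dis : Dissection n D) (C : Cell n D vs)
                    (s : ℕ) (2≤s : 2 ≤ s) (s+4≤k : s + 4 ≤ length vs)
                    (side∈D : side vs s ∈ D) (base∈D : baseSide vs ∈ D) where
  open Dissection dis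
  open CellFacts dis C
  open ChordPlacement dis C
  open Surgery dis C s 2≤s s+4≤k side∈D base∈D

  VertexChord : Pt → Set
  VertexChord p = ∃ λ i → ∃ λ j → i < j × j < k × p ≡ (v i , v j)

  S-vertexChord : VertexChord S
  S-vertexChord = s , suc s , ≤-refl , s+1<k , refl

  B-vertexChord : VertexChord B
  B-vertexChord = 0 , last , ≤-trans (s≤s z≤n) 2≤last , last<k , refl

  L-vertexChord : VertexChord L
  L-vertexChord = 0 , s , 0<s , s<k , refl

  R-vertexChord : VertexChord R
  R-vertexChord = suc s , last , s+1<last , last<k , refl

  vertexChord-bounds : ∀ {p} → VertexChord p → a ≤ proj₁ p × proj₂ p ≤ b
  vertexChord-bounds (i , j , i<j , j<k , refl) = a≤v i (<-trans i<j j<k) , v≤b j j<k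

  vertexChord-in-gap : ∀ {p c d} u → VertexChord p → suc u < k → v u ≤ c → d ≤ v (suc u) →
                       c ≤ proj₁ p → proj₂ p ≤ d → p ≡ (c , d)
  vertexChord-in-gap {c = c} {d} u (i , j , i<j , j<k , refl) u+1< vu≤c d≤vu+1 c≤vi vj≤d =
    cong₂ _,_ (≤-antisym (subst (λ z → v z ≤ c) (sym i≡u) vu≤c) c≤vi)
              (≤-antisym vj≤d (subst (λ z → d ≤ v z) (sym j≡u+1) d≤vu+1))
    where
    u≤i : u ≤ i
    u≤i = ≮⇒≥ λ i<u → <⇒≱ (increasing-< inc i u i<u (<-trans (n<1+n u) u+1<)) (≤-trans vu≤c c≤vi)
    j≤u+1 : j ≤ suc u
    j≤u+1 = ≮⇒≥ λ u+1<j → <⇒≱ (increasing-< inc (suc u) j u+1<j j<k) (≤-trans vj≤d d≤vu+1)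
    i≡u : i ≡ u
    i≡u = ≤-antisym (≤-pred (<-≤-trans i<j j≤u+1)) u≤i
    j≡u+1 : j ≡ suc u
    j≡u+1 = ≤-antisym j≤u+1 (subst (_< j) i≡u i<j)

  hidden′⇒hidden : ∀ Q x → (∀ p → VertexChord p → Hides Q x p → Hidden D Q x) → Hidden D′ Q x → Hidden D Q x
  hidden′⇒hidden Q x via (p , p∈ , hides) with ∈D′⁻ p∈
  ... | inj₁ refl = via p L-vertexChord hides
  ... | inj₂ (inj₁ refl) = via p R-vertexChord hides
  ... | inj₂ (inj₂ (p∈D , _)) = p , p∈D , hides

  hidden⇒hidden′ : ∀ Q x → (∀ p → VertexChord p → Hides Q x p → Hidden D′ Q x) → Hidden D Q x → Hidden D′ Q x
  hidden⇒hidden′ Q x via (p , p∈D , hides) with p ≟ᴾ S | p ≟ᴾ B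
  ... | yes refl | _ = via p S-vertexChord hides
  ... | no _ | yes refl = via p B-vertexChord hides
  ... | no p≢S | no p≢B = p , ∈D′⁺ p∈D p≢S p≢B , hides

  cellOf-unchanged : ∀ Q → (∀ x p → VertexChord p → Hides Q x p → Hidden D Q x)
                         → (∀ x p → VertexChord p → Hides Q x p → Hidden D′ Q x)
                         → cellOf D′ Q ≡ cellOf D Q
  cellOf-unchanged Q to-D to-D′ = filter-≐ (OnCell? D′ Q) (OnCell? D Q)
    ((λ (x≥ , x≤ , not-hidden′) → x≥ , x≤ , λ h → not-hidden′ (hidden⇒hidden′ Q _ (to-D′ _) h)) ,
     (λ (x≥ , x≤ , not-hidden) → x≥ , x≤ , λ h′ → not-hidden (hidden′⇒hidden Q _ (to-D _) h′)))
    (upTo (suc (proj₂ Q)))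

  cellOf-unchanged-if-unhidden : ∀ Q → (∀ x p → VertexChord p → ¬ Hides Q x p) → cellOf D′ Q ≡ cellOf D Q
  cellOf-unchanged-if-unhidden Q none =
    cellOf-unchanged Q (λ x p vc h → ⊥-elim (none x p vc h)) (λ x p vc h → ⊥-elim (none x p vc h))

  cellOf-unchanged-away : ∀ c d → (c , d) ∈ D → ¬ (c ≤ a × b ≤ d) → cellOf D′ (c , d) ≡ cellOf D (c , d)
  cellOf-unchanged-away c d cd∈D not-around = cellOf-unchanged-if-unhidden (c , d) (unhidden (placement c d cd∈D))
    where
    unhidden : Placement (c , d) → ∀ x p → VertexChord p → ¬ Hides (c , d) x p
    unhidden (left d≤a) x p vc (_ , _ , p₂≤d , p₁<x , x<p₂) =
      <⇒≱ (<-trans p₁<x x<p₂) (≤-trans p₂≤d (≤-trans d≤a (proj₁ (vertexChord-bounds vc))))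
    unhidden (right b≤c) x p vc (_ , c≤p₁ , _ , p₁<x , x<p₂) =
      <⇒≱ (<-trans p₁<x x<p₂) (≤-trans (proj₂ (vertexChord-bounds vc)) (≤-trans b≤c c≤p₁))
    unhidden (around c≤a b≤d) = ⊥-elim (not-around (c≤a , b≤d))
    unhidden (in-gap u u+1< vu≤c d≤vu+1) x p vc (p≢cd , c≤p₁ , p₂≤d , _ , _) =
      p≢cd (vertexChord-in-gap u vc u+1< vu≤c d≤vu+1 c≤p₁ p₂≤d)

  chord-inside-base : ∀ c d → (c , d) ∈ D → (c , d) ≢ B → a ≤ c → d ≤ b →
                      ∃ λ u → suc u < k × v u ≤ c × d ≤ v (suc u)
  chord-inside-base c d cd∈D cd≢B a≤c d≤b with placement c d cd∈D
  ... | left d≤a = ⊥-elim (<⇒≱ (chord-< (chords _ cd∈D)) (≤-trans d≤a a≤c))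
  ... | right b≤c = ⊥-elim (<⇒≱ (chord-< (chords _ cd∈D)) (≤-trans d≤b b≤c))
  ... | around c≤a b≤d = ⊥-elim (cd≢B (cong₂ _,_ (≤-antisym c≤a a≤c) (≤-antisym d≤b b≤d)))
  ... | in-gap u u+1< vu≤c d≤vu+1 = u , u+1< , vu≤c , d≤vu+1

  cellOf′-L : cellOf D′ L ≡ take (suc s) vs
  cellOf′-L = sorted-≡ (cellOf-sorted D′ L) (AllPairs.take⁺ (suc s) (Increasing⇒AllPairs inc))
                (λ x∈ → to (∈-cellOf⁻ x∈)) (λ x∈ → ∈-cellOf⁺ (from x∈))
    where
    to : ∀ {x} → OnCell D′ L x → x ∈ take (suc s) vs
    to {x} (a≤x , x≤vs , not-hidden′) with ∈⇒∈! (onCell⇒∈ (a≤x , ≤-trans x≤vs (<⇒≤ vs<b) , not-hidden))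
      where
      not-hidden : ¬ Hidden D B x
      not-hidden ((c , d) , cd∈D , cd≢B , a≤c , d≤b , c<x , x<d) with chord-inside-base c d cd∈D cd≢B a≤c d≤b
      ... | u , u+1< , vu≤c , d≤vu+1 =
        not-hidden′ (_ , ∈D′⁺ cd∈D cd≢S cd≢B , (λ e → L∉D (subst (_∈ D) e cd∈D)) , a≤c ,
                     ≤-trans d≤vu+1 (increasing-≤ inc (suc u) s u+1≤s s<k) , c<x , x<d)
        where
        u+1≤s : suc u ≤ s
        u+1≤s = increasing-cancel-< inc u s (<-trans (n<1+n u) u+1<) (≤-<-trans vu≤c (<-≤-trans c<x x≤vs))
        cd≢S : (c , d) ≢ S
        cd≢S e = <⇒≱ (<-≤-trans c<x x≤vs) (≤-reflexive (sym (cong proj₁ e)))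
    ... | t , t<k , refl = ∈-take⁺ {xs = vs} (suc s) t (s≤s (≮⇒≥ λ s<t → <⇒≱ (increasing-< inc s t s<t t<k) x≤vs)) t<k
    from : ∀ {x} → x ∈ take (suc s) vs → OnCell D′ L x
    from x∈ with t , t≤s , t<k , refl ← ∈-take⁻ {xs = vs} (suc s) x∈ =
      a≤v t t<k , increasing-≤ inc t s (≤-pred t≤s) s<k , not-hidden′
      where
      not-hidden′ : ¬ Hidden D′ L (v t)
      not-hidden′ (q , q∈ , (q≢L , a≤q₁ , q₂≤vs , q₁<vt , vt<q₂)) with ∈D′⁻ q∈
      ... | inj₁ refl = q≢L refl
      ... | inj₂ (inj₁ refl) = <⇒≱ vs<b q₂≤vs
      ... | inj₂ (inj₂ (q∈D , _ , q≢B)) =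
        vertex-not-hidden t t<k (q , q∈D , q≢B , a≤q₁ , ≤-trans q₂≤vs (<⇒≤ vs<b) , q₁<vt , vt<q₂)

  cellOf′-R : cellOf D′ R ≡ drop (suc s) vs
  cellOf′-R = sorted-≡ (cellOf-sorted D′ R) (AllPairs.drop⁺ (suc s) (Increasing⇒AllPairs inc))
                (λ x∈ → to (∈-cellOf⁻ x∈)) (λ x∈ → ∈-cellOf⁺ (from x∈))
    where
    to : ∀ {x} → OnCell D′ R x → x ∈ drop (suc s) vs
    to {x} (vs+1≤x , x≤b , not-hidden′) with ∈⇒∈! (onCell⇒∈ (≤-trans (<⇒≤ a<vs+1) vs+1≤x , x≤b , not-hidden))
      where
      not-hidden : ¬ Hidden D B x
      not-hidden ((c , d) , cd∈D , cd≢B , a≤c , d≤b , c<x , x<d) with chord-inside-base c d cd∈D cd≢B a≤c d≤b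
      ... | u , u+1< , vu≤c , d≤vu+1 =
        not-hidden′ (_ , ∈D′⁺ cd∈D cd≢S cd≢B , (λ e → R∉D (subst (_∈ D) e cd∈D)) ,
                     ≤-trans (increasing-≤ inc (suc s) u s+1≤u (<-trans (n<1+n u) u+1<)) vu≤c , d≤b , c<x , x<d)
        where
        s+1≤u : suc s ≤ u
        s+1≤u = ≤-pred (increasing-cancel-< inc (suc s) (suc u) s+1<k (≤-<-trans vs+1≤x (<-≤-trans x<d d≤vu+1)))
        cd≢S : (c , d) ≢ S
        cd≢S e = <⇒≱ (<-≤-trans x<d (≤-reflexive (cong proj₂ e))) vs+1≤x
    ... | t , t<k , refl = ∈-drop⁺ {xs = vs} (suc s) t (≮⇒≥ λ t<s+1 → <⇒≱ (increasing-< inc t (suc s) t<s+1 s+1<k) vs+1≤x) t<k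
    from : ∀ {x} → x ∈ drop (suc s) vs → OnCell D′ R x
    from x∈ with t , s+1≤t , t<k , refl ← ∈-drop⁻ {xs = vs} (suc s) x∈ =
      increasing-≤ inc (suc s) t s+1≤t t<k , v≤b t t<k , not-hidden′
      where
      not-hidden′ : ¬ Hidden D′ R (v t)
      not-hidden′ (q , q∈ , (q≢R , vs+1≤q₁ , q₂≤b , q₁<vt , vt<q₂)) with ∈D′⁻ q∈
      ... | inj₁ refl = <⇒≱ a<vs+1 vs+1≤q₁
      ... | inj₂ (inj₁ refl) = q≢R refl
      ... | inj₂ (inj₂ (q∈D , _ , q≢B)) =
        vertex-not-hidden t t<k (q , q∈D , q≢B , ≤-trans (<⇒≤ a<vs+1) vs+1≤q₁ , q₂≤b , q₁<vt , vt<q₂)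

  length-cellOf′-L : length (cellOf D′ L) ≡ suc s
  length-cellOf′-L = trans (cong length cellOf′-L) (trans (length-take (suc s) vs) (m≤n⇒m⊓n≡m (<⇒≤ s+1<k)))

  length-cellOf′-R : length (cellOf D′ R) ≡ k ∸ suc s
  length-cellOf′-R = trans (cong length cellOf′-R) (length-drop (suc s) vs)

  module AroundBase (c d : ℕ) (c≤a : c ≤ a) (b≤d : b ≤ d) (Q≢B : (c , d) ≢ B) (Q≢L : (c , d) ≢ L) (Q≢R : (c , d) ≢ R) where
    Q : Pt
    Q = (c , d)

    inside-base : ∀ x p → VertexChord p → Hides Q x p → a < x × x < b
    inside-base x p vc (_ , _ , _ , p₁<x , x<p₂) =
      ≤-<-trans (proj₁ (vertexChord-bounds vc)) p₁<x , <-≤-trans x<p₂ (proj₂ (vertexChord-bounds vc))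

    hides-all-inside : ∀ r → r ∈ D → Hides Q a r ⊎ Hides Q b r → ∀ x → a < x → x < b → Hides Q x r
    hides-all-inside (r₁ , r₂) r∈D hides-end x a<x x<b = spread (placement r₁ r₂ r∈D) hides-end
      where
      spread : Placement (r₁ , r₂) → Hides Q a (r₁ , r₂) ⊎ Hides Q b (r₁ , r₂) → Hides Q x (r₁ , r₂)
      spread (around _ b≤r₂) (inj₁ (r≢Q , c≤r₁ , r₂≤d , r₁<a , _)) =
        r≢Q , c≤r₁ , r₂≤d , <-trans r₁<a a<x , <-≤-trans x<b b≤r₂
      spread (around r₁≤a _) (inj₂ (r≢Q , c≤r₁ , r₂≤d , _ , b<r₂)) =
        r≢Q , c≤r₁ , r₂≤d , ≤-<-trans r₁≤a a<x , <-trans x<b b<r₂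
      spread (left r₂≤a) (inj₁ (_ , _ , _ , _ , a<r₂)) = ⊥-elim (<⇒≱ a<r₂ r₂≤a)
      spread (left r₂≤a) (inj₂ (_ , _ , _ , _ , b<r₂)) = ⊥-elim (<⇒≱ (<-trans a<b b<r₂) r₂≤a)
      spread (right b≤r₁) (inj₁ (_ , _ , _ , r₁<a , _)) = ⊥-elim (<⇒≱ (<-trans r₁<a a<b) b≤r₁)
      spread (right b≤r₁) (inj₂ (_ , _ , _ , r₁<b , _)) = ⊥-elim (<⇒≱ r₁<b b≤r₁)
      spread (in-gap u u+1< vu≤r₁ _) (inj₁ (_ , _ , _ , r₁<a , _)) =
        ⊥-elim (<⇒≱ r₁<a (≤-trans (a≤v u (<-trans (n<1+n u) u+1<)) vu≤r₁))
      spread (in-gap u u+1< _ r₂≤vu+1) (inj₂ (_ , _ , _ , _ , b<r₂)) =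
        ⊥-elim (<⇒≱ b<r₂ (≤-trans r₂≤vu+1 (v≤b (suc u) u+1<)))

    not-vertexChord : ∀ r → Hides Q a r ⊎ Hides Q b r → ∀ p → VertexChord p → r ≢ p
    not-vertexChord r (inj₁ (_ , _ , _ , r₁<a , _)) p vc refl = <⇒≱ r₁<a (proj₁ (vertexChord-bounds vc))
    not-vertexChord r (inj₂ (_ , _ , _ , _ , b<r₂)) p vc refl = <⇒≱ b<r₂ (proj₂ (vertexChord-bounds vc))

    cellOf-unchanged-below : ∀ r → r ∈ D → Hides Q a r ⊎ Hides Q b r → cellOf D′ Q ≡ cellOf D Q
    cellOf-unchanged-below r r∈D hides-end =
      cellOf-unchanged Q (λ x p vc h → r , r∈D , hides x p vc h) (λ x p vc h → r , r∈D′ , hides x p vc h)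
      where
      hides : ∀ x p → VertexChord p → Hides Q x p → Hides Q x r
      hides x p vc h = let (a<x , x<b) = inside-base x p vc h in hides-all-inside r r∈D hides-end x a<x x<b
      r∈D′ : r ∈ D′
      r∈D′ = ∈D′⁺ r∈D (not-vertexChord r hides-end S S-vertexChord) (not-vertexChord r hides-end B B-vertexChord)

    module ParentOfBase (a-on : OnCell D Q a) (b-on : OnCell D Q b) where
      B-hides : ∀ x → a < x → x < b → Hides Q x B
      B-hides x a<x x<b = (λ e → Q≢B (sym e)) , c≤a , b≤d , a<x , x<b

      from-Q : ∀ {x} → OnCell D Q x → OnCell D′ Q x
      from-Q (c≤x , x≤d , not-hidden) =
        c≤x , x≤d , λ h′ → not-hidden (hidden′⇒hidden Q _ (λ p vc h → let (a<x , x<b) = inside-base _ p vc h in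
                                                                        B , base∈D , B-hides _ a<x x<b) h′)

      from-S : ∀ {x} → OnCell D S x → OnCell D′ Q x
      from-S {x} (vs≤x , x≤vs+1 , not-hidden-S) =
        ≤-trans c≤a (≤-trans (<⇒≤ a<vs) vs≤x) , ≤-trans x≤vs+1 (≤-trans (<⇒≤ vs+1<b) b≤d) , not-hidden′
        where
        unhidden-by-old : ∀ p → p ∈ D → p ≢ S → p ≢ B → Hides Q x p → Placement p → ⊥
        unhidden-by-old p p∈D p≢S p≢B (_ , _ , _ , _ , x<p₂) (left p₂≤a) =
          <⇒≱ x<p₂ (≤-trans p₂≤a (≤-trans (<⇒≤ a<vs) vs≤x))
        unhidden-by-old p p∈D p≢S p≢B (_ , _ , _ , p₁<x , _) (right b≤p₁) =
          <⇒≱ p₁<x (≤-trans x≤vs+1 (≤-trans (<⇒≤ vs+1<b) b≤p₁))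
        unhidden-by-old (p₁ , p₂) p∈D p≢S p≢B (p≢Q , c≤p₁ , p₂≤d , _ , _) (around p₁≤a b≤p₂)
          with m≤n⇒m<n∨m≡n p₁≤a | m≤n⇒m<n∨m≡n b≤p₂
        ... | inj₁ p₁<a | _ = proj₂ (proj₂ a-on) (_ , p∈D , p≢Q , c≤p₁ , p₂≤d , p₁<a , <-≤-trans a<b b≤p₂)
        ... | inj₂ refl | inj₁ b<p₂ = proj₂ (proj₂ b-on) (_ , p∈D , p≢Q , c≤p₁ , p₂≤d , a<b , b<p₂)
        ... | inj₂ refl | inj₂ refl = p≢B refl
        unhidden-by-old (p₁ , p₂) p∈D p≢S p≢B (p≢Q , c≤p₁ , p₂≤d , p₁<x , x<p₂) (in-gap u u+1< vu≤p₁ p₂≤vu+1) =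
          not-hidden-S (_ , p∈D , p≢S , subst (λ z → v z ≤ p₁) u≡s vu≤p₁ ,
                        subst (λ z → p₂ ≤ v (suc z)) u≡s p₂≤vu+1 , p₁<x , x<p₂)
          where
          u<s+1 : u < suc s
          u<s+1 = increasing-cancel-< inc u (suc s) (<-trans (n<1+n u) u+1<) (≤-<-trans vu≤p₁ (<-≤-trans p₁<x x≤vs+1))
          s<u+1 : s < suc u
          s<u+1 = increasing-cancel-< inc s (suc u) s<k (≤-<-trans vs≤x (<-≤-trans x<p₂ p₂≤vu+1))
          u≡s : u ≡ s
          u≡s = ≤-antisym (≤-pred u<s+1) (≤-pred s<u+1)
        not-hidden′ : ¬ Hidden D′ Q x
        not-hidden′ (p , p∈ , h@(_ , _ , _ , p₁<x , x<p₂)) with ∈D′⁻ p∈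
        ... | inj₁ refl = <⇒≱ x<p₂ vs≤x
        ... | inj₂ (inj₁ refl) = <⇒≱ p₁<x x≤vs+1
        ... | inj₂ (inj₂ (p∈D , p≢S , p≢B)) = unhidden-by-old p p∈D p≢S p≢B h (placement _ _ p∈D)

      split : ∀ {x} → OnCell D′ Q x → OnCell D Q x ⊎ OnCell D S x
      split {x} (c≤x , x≤d , not-hidden′) with a <? x | x <? b
      ... | no a≮x | _ = inj₁ (c≤x , x≤d , λ h → not-hidden′ (hidden⇒hidden′ Q x
                              (λ p vc h′ → ⊥-elim (a≮x (proj₁ (inside-base x p vc h′)))) h))
      ... | yes _ | no x≮b = inj₁ (c≤x , x≤d , λ h → not-hidden′ (hidden⇒hidden′ Q x
                                  (λ p vc h′ → ⊥-elim (x≮b (proj₂ (inside-base x p vc h′)))) h))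
      ... | yes a<x | yes x<b with x <? v s | v (suc s) <? x
      ...   | yes x<vs | _ =
        ⊥-elim (not-hidden′ (L , L∈D′ , (λ e → Q≢L (sym e)) , c≤a , ≤-trans (<⇒≤ vs<b) b≤d , a<x , x<vs))
      ...   | no _ | yes vs+1<x =
        ⊥-elim (not-hidden′ (R , R∈D′ , (λ e → Q≢R (sym e)) , ≤-trans c≤a (<⇒≤ a<vs+1) , b≤d , vs+1<x , x<b))
      ...   | no x≮vs | no vs+1≮x = inj₂ (≮⇒≥ x≮vs , ≮⇒≥ vs+1≮x , not-hidden-S)
        where
        not-hidden-S : ¬ Hidden D S x
        not-hidden-S (p , p∈D , p≢S , vs≤p₁ , p₂≤vs+1 , p₁<x , x<p₂) =
          not-hidden′ (p , ∈D′⁺ p∈D p≢S p≢B , p≢Q , ≤-trans c≤a (≤-trans (<⇒≤ a<vs) vs≤p₁) ,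
                       ≤-trans p₂≤vs+1 (≤-trans (<⇒≤ vs+1<b) b≤d) , p₁<x , x<p₂)
          where
          p≢B : p ≢ B
          p≢B e = <⇒≱ a<vs (≤-trans vs≤p₁ (≤-reflexive (cong proj₁ e)))
          p≢Q : p ≢ Q
          p≢Q e = <⇒≱ a<vs (≤-trans vs≤p₁ (≤-trans (≤-reflexive (cong proj₁ e)) c≤a))

      disjoint : ∀ {x} → OnCell D Q x → ¬ OnCell D S x
      disjoint (_ , _ , not-hidden) (vs≤x , x≤vs+1 , _) =
        not-hidden (B , base∈D , B-hides _ (<-≤-trans a<vs vs≤x) (≤-<-trans x≤vs+1 vs+1<b))

      filter-S≡cellOf : filter (OnCell? D S) (upTo (suc d)) ≡ cellOf D S
      filter-S≡cellOf = sorted-≡ (AllPairs.filter⁺ (OnCell? D S) (AllPairs.applyUpTo⁺₁ (λ i → i) _ (λ i<j _ → i<j)))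
                                  (cellOf-sorted D S)
                                  (λ x∈ → ∈-cellOf⁺ (proj₂ (∈-filter⁻ (OnCell? D S) x∈)))
                                  (λ x∈ → let on = ∈-cellOf⁻ x∈ in
                                     ∈-filter⁺ (OnCell? D S) (∈-upTo⁺ (s≤s (proj₁ (proj₂ (from-S on))))) on)

      length-cellOf′ : length (cellOf D′ Q) ≡ length (cellOf D Q) + length (cellOf D S)
      length-cellOf′ = begin
        length (cellOf D′ Q)
          ≡⟨ cong length (filter-≐ (OnCell? D′ Q) (OnCell? D Q ∪? OnCell? D S) (split , [ from-Q , from-S ]′) range) ⟩
        length (filter (OnCell? D Q ∪? OnCell? D S) range)
          ≡⟨ length-filter-∪ (OnCell? D Q) (OnCell? D S) disjoint range ⟩
        length (cellOf D Q) + length (filter (OnCell? D S) range)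
          ≡⟨ cong (λ l → length (cellOf D Q) + length l) filter-S≡cellOf ⟩
        length (cellOf D Q) + length (cellOf D S)
          ∎
        where
        open ≡-Reasoning
        range = upTo (suc d)

  module _ (periodic : ThreePeriodic n D) (1≤n : 1 ≤ n) (3∣s+1 : 3 ∣ suc s) where
    3∣cellOf : ∀ {c d} → CellBase n D (c , d) → 3 ∣ length (cellOf D (c , d))
    3∣cellOf {c} {d} q-base = m%n≡0⇒n∣m _ 3 (periodic _ (proj₁ (cellOf-isCell dis 1≤n c d q-base)))

    3∣cellOf′-around : ∀ c d → CellBase n D (c , d) → c ≤ a → b ≤ d →
                       (c , d) ≢ B → (c , d) ≢ L → (c , d) ≢ R → 3 ∣ length (cellOf D′ (c , d))
    3∣cellOf′-around c d q-base c≤a b≤d Q≢B Q≢L Q≢R = by-endpoints (OnCell? D Q a) (OnCell? D Q b)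
      where
      open AroundBase c d c≤a b≤d Q≢B Q≢L Q≢R
      unchanged : ∀ r → r ∈ D → Hides Q a r ⊎ Hides Q b r → 3 ∣ length (cellOf D′ Q)
      unchanged r r∈D hides-end = subst (λ l → 3 ∣ length l) (sym (cellOf-unchanged-below r r∈D hides-end)) (3∣cellOf q-base)
      by-endpoints : Dec (OnCell D Q a) → Dec (OnCell D Q b) → 3 ∣ length (cellOf D′ Q)
      by-endpoints (yes a-on) (yes b-on) =
        subst (3 ∣_) (sym (ParentOfBase.length-cellOf′ a-on b-on)) (∣m∣n⇒∣m+n (3∣cellOf q-base) (3∣cellOf (inj₁ S∈D)))
      by-endpoints (no a-off) _ with r , r∈D , hides ← off⇒hidden c≤a (≤-trans (<⇒≤ a<b) b≤d) a-off =
        unchanged r r∈D (inj₁ hides)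
      by-endpoints (yes _) (no b-off) with r , r∈D , hides ← off⇒hidden (≤-trans c≤a (<⇒≤ a<b)) b≤d b-off =
        unchanged r r∈D (inj₂ hides)

    3∣cellOf′-away : ∀ c d → (c , d) ∈ D → ¬ (c ≤ a × b ≤ d) → 3 ∣ length (cellOf D′ (c , d))
    3∣cellOf′-away c d cd∈D not-around =
      subst (λ l → 3 ∣ length l) (sym (cellOf-unchanged-away c d cd∈D not-around)) (3∣cellOf (inj₁ cd∈D))

    3∣cellOf′-old-base : ∀ c d → CellBase n D (c , d) → (c , d) ≢ B → (c , d) ≢ L → (c , d) ≢ R →
                    3 ∣ length (cellOf D′ (c , d))
    3∣cellOf′-old-base c d (inj₂ refl) = 3∣cellOf′-around c d (inj₂ refl) z≤n b≤n+1
    3∣cellOf′-old-base c d (inj₁ cd∈D) Q≢B Q≢L Q≢R = by-position (c ≤? a) (b ≤? d)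
      where
      by-position : Dec (c ≤ a) → Dec (b ≤ d) → 3 ∣ length (cellOf D′ (c , d))
      by-position (yes c≤a) (yes b≤d) = 3∣cellOf′-around c d (inj₁ cd∈D) c≤a b≤d Q≢B Q≢L Q≢R
      by-position (no c≰a) _ = 3∣cellOf′-away c d cd∈D (λ (c≤a , _) → c≰a c≤a)
      by-position (yes _) (no b≰d) = 3∣cellOf′-away c d cd∈D (λ (_ , b≤d) → b≰d b≤d)

    3∣cellOf′ : ∀ q → CellBase n D′ q → 3 ∣ length (cellOf D′ q)
    3∣cellOf′ q (inj₁ q∈D′) with ∈D′⁻ q∈D′
    ... | inj₁ refl = subst (3 ∣_) (sym length-cellOf′-L) 3∣s+1
    ... | inj₂ (inj₁ refl) = subst (3 ∣_) (sym length-cellOf′-R)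
                               (∣m+n∣m⇒∣n (subst (3 ∣_) (sym (m+[n∸m]≡n (<⇒≤ s+1<k))) 3∣k) 3∣s+1)
      where
      3∣k : 3 ∣ k
      3∣k = m%n≡0⇒n∣m k 3 (periodic vs C)
    ... | inj₂ (inj₂ (q∈D , _ , q≢B)) =
      3∣cellOf′-old-base _ _ (inj₁ q∈D) q≢B (λ e → L∉D (subst (_∈ D) e q∈D)) (λ e → R∉D (subst (_∈ D) e q∈D))
    3∣cellOf′ q (inj₂ refl) =
      3∣cellOf′-old-base _ _ (inj₂ refl) (edge≢chord B (chords B base∈D)) (edge≢chord L L-chord) (edge≢chord R R-chord)
      where
      edge≢chord : ∀ p → IsChord n p → baseEdge n ≢ p
      edge≢chord p (_ , _ , not-edge) e = not-edge (cong proj₁ (sym e) , cong proj₂ (sym e))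

    three-periodic′ : ThreePeriodic n D′
    three-periodic′ ws W =
      n∣m⇒m%n≡0 _ 3 (subst (λ l → 3 ∣ length l) (sym W′.cell≡cellOf) (3∣cellOf′ (W′.a , W′.b) W′.base-cellBase))
      where module W′ = CellFacts dissection′ W

-- Maximally open dissections

c+s+1≡c+[1+s] : ∀ c s → c + s + 1 ≡ c + suc s
c+s+1≡c+[1+s] c s = trans (+-assoc c s 1) (cong (c +_) (+-comm s 1))

side-index-stable : ∀ {c s} → c < 3 → 3 ∣ suc s → (c + s + 1) % 3 ≡ c
side-index-stable {c} {s} c<3 (divides q s+1≡q*3) = begin
  (c + s + 1) % 3  ≡⟨ cong (_% 3) (c+s+1≡c+[1+s] c s) ⟩
  (c + suc s) % 3  ≡⟨ cong (λ x → (c + x) % 3) s+1≡q*3 ⟩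
  (c + q * 3) % 3  ≡⟨ [m+kn]%n≡m%n c q 3 ⟩
  c % 3            ≡⟨ m<n⇒m%n≡m c<3 ⟩
  c                ∎
  where open ≡-Reasoning

side-index-stable⁻ : ∀ {c s} → (c + s + 1) % 3 ≡ c → 3 ∣ suc s
side-index-stable⁻ {c} {s} stable = divides ((c + suc s) / 3) (+-cancelˡ-≡ c _ _ (begin
  c + suc s                               ≡⟨ m≡m%n+[m/n]*n (c + suc s) 3 ⟩
  (c + suc s) % 3 + (c + suc s) / 3 * 3   ≡⟨ cong (λ r → r % 3 + (c + suc s) / 3 * 3) (c+s+1≡c+[1+s] c s) ⟨
  (c + s + 1) % 3 + (c + suc s) / 3 * 3   ≡⟨ cong (_+ (c + suc s) / 3 * 3) stable ⟩
  c + (c + suc s) / 3 * 3                 ∎))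
  where open ≡-Reasoning

-- The conditions of an opening surgery on the side s and the base side of V, with the equality of
-- indices already reduced to 3 ∣ s + 1 by side-index-stable.
OpenableAt : List Pt → List ℕ → ℕ → Set
OpenableAt D V s = 2 ≤ s × s + 4 ≤ length V × 3 ∣ suc s × side V s ∈ D

OpenableAt? : ∀ D V s → Dec (OpenableAt D V s)
OpenableAt? D V s = (2 ≤? s) ×-dec (s + 4 ≤? length V) ×-dec (3 ∣? suc s) ×-dec any? (side V s ≟ᴾ_) D

Openable : List Pt → Set
Openable D = ∃ λ q → q ∈ D × ∃ λ s → OpenableAt D (cellOf D q) s

openable? : ∀ D → Dec (Openable D)
openable? D with ∃∈? (λ q → ∃∈? (OpenableAt? D (cellOf D q)) (upTo (length (cellOf D q)))) D
... | yes (q , q∈D , s , _ , openable) = yes (q , q∈D , s , openable)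
... | no none = no λ (q , q∈D , s , openable@(_ , s+4≤ , _)) →
  none (q , q∈D , s , ∈-upTo⁺ (≤-trans (m≤m+n (suc s) 3) (subst (_≤ length (cellOf D q)) (+-suc s 3) s+4≤)) , openable)

module _ {n : ℕ} {D : List Pt} (dis : Dissection n D) where

  opening⇒openable : ∀ {vs s s′} → OpeningSurgery n D vs s s′ → Openable D
  opening⇒openable {vs} {s} {s′} surgery =
    baseSide vs , base∈D , s , subst (λ V → OpenableAt D V s) V.cell≡cellOf (2≤s , s+4≤k , 3∣s+1 , chord₁)
    where
    open OpeningSurgery surgery
    module V = CellFacts dis cell
    side≡base : side vs s′ ≡ baseSide vs
    side≡base = trans (side-last vs s′ isBase) (cong (λ t → (vs ! 0 , vs ! t)) (V.last-unique s′ isBase))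
    base∈D : baseSide vs ∈ D
    base∈D = subst (_∈ D) side≡base chord₂
    2≤s : 2 ≤ s
    2≤s = +-cancelʳ-≤ (suc s′) 2 s (subst₂ _≤_ (+-comm s′ 3) (cong (s +_) (sym isBase)) (proj₂ distant))
    s+4≤k : s + 4 ≤ length vs
    s+4≤k = subst₂ _≤_ (sym (+-suc s 3)) isBase (s≤s (proj₁ distant))
    s+1<k : suc s < length vs
    s+1<k = ≤-trans (s≤s lt) (≤-reflexive isBase)
    3∣s+1 : 3 ∣ suc s
    3∣s+1 with c , side-index , base-index ← sameIdx =
      side-index-stable⁻ (sym (index-unique dis side-index
        (step cell (subst (λ p → Index n D p c) side≡base base-index) s+1<k) refl))

  ¬openable⇒maximallyOpen : ¬ Openable D → MaximallyOpen n D
  ¬openable⇒maximallyOpen not-openable vs s s′ surgery = not-openable (opening⇒openable surgery)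

  module _ (periodic : ThreePeriodic n D) (1≤n : 1 ≤ n) where
    open-once : Openable D →
                ∃ λ D′ → OpeningStep n D D′ × spanSum D′ < spanSum D × Dissection n D′ × ThreePeriodic n D′
    open-once ((A , B) , AB∈D , s , 2≤s , s+4≤k , 3∣s+1 , side∈D) =
      D′ , opening-step , spanSum-decreases , dissection′ , three-periodic′ periodic 1≤n 3∣s+1
      where
      V = cellOf D (A , B)
      C = proj₁ (cellOf-isCell dis 1≤n A B (inj₁ AB∈D))
      base∈D : baseSide V ∈ D
      base∈D = subst (_∈ D) (sym (proj₂ (cellOf-isCell dis 1≤n A B (inj₁ AB∈D)))) AB∈D
      open CellFacts dis C using (last; suc-last)
      open Surgery dis C s 2≤s s+4≤k side∈D base∈D
      open SurgeryCells dis C s 2≤s s+4≤k side∈D base∈D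
      -- The index c stays a variable: unfolding index-of would evaluate the whole search for parent cells.
      opening : ∀ {c} → Index n D (baseSide V) c → OpeningSurgery n D V s last
      opening {c} base-index = record
        { cell = C
        ; isBase = suc-last
        ; lt = s<last
        ; distant = s+3≤last ,
                    ≤-trans (≤-reflexive (trans (+-comm last 3) (cong (2 +_) suc-last))) (+-monoˡ-≤ (length V) 2≤s)
        ; chord₁ = side∈D
        ; chord₂ = subst (_∈ D) (sym side≡B) base∈D
        ; sameIdx = c , subst (Index n D (side V s)) (side-index-stable (index<3 dis base-index) 3∣s+1)
                          (step C base-index s+1<k) ,
                        subst (λ p → Index n D p c) (sym side≡B) base-index
        }
      opening-step : OpeningStep n D D′
      opening-step = dis , periodic , dissection′ , V , s , last ,
                     opening (proj₂ (index-of dis 1≤n (baseSide V) (inj₁ base∈D))) , surgery-result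

module _ {n : ℕ} (1≤n : 1 ≤ n) where
  MaximallyOpened : List Pt → Set
  MaximallyOpened D =
    ∃ λ D′ → Star (OpeningStep n) D D′ × Dissection n D′ × ThreePeriodic n D′ × MaximallyOpen n D′

  open-until-maximal : ∀ fuel D → spanSum D < fuel → Dissection n D → ThreePeriodic n D → MaximallyOpened D
  open-until-maximal (suc fuel) D spanSum<fuel dis periodic = continue (openable? D)
    where
    continue : Dec (Openable D) → MaximallyOpened D
    continue (no not-openable) = D , ε , dis , periodic , ¬openable⇒maximallyOpen dis not-openable
    continue (yes openable) =
      let D′ , first , smaller , dis′ , periodic′ = open-once dis periodic 1≤n openable
          D″ , steps , result = open-until-maximal fuel D′ (<-≤-trans smaller (≤-pred spanSum<fuel)) dis′ periodic′
      in D″ , first ◅ steps , result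

proposition6p16 : (n : ℕ) → 1 ≤ n → (D : List Pt) → Dissection n D → ThreePeriodic n D
                  → ∃ λ D' → Star (OpeningStep n) D D' × Dissection n D'
                    × ThreePeriodic n D' × MaximallyOpen n D'
proposition6p16 n 1≤n D dis periodic = open-until-maximal 1≤n (suc (spanSum D)) D ≤-refl dis periodic
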